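{- For every positive integer $n$ there exists a nearly extremal word of length at least $n$ over a $3$-letter alphabet $\mathbb A$.
   Context: A square is a non-empty word of the form $XX$; a word is square-free if it contains no square as a factor (contiguous subword). For a word $W$ over $\mathbb A$, an extension of $W$ is any word $W'xW''$ with $x\in\mathbb A$ and $W=W'W''$ ($W'$, $W''$ possibly empty). A square-free word $W$ over $\mathbb A$ is nearly extremal if every square-free extension $W'xW''$ of $W$ has $W'$ empty or $W''$ empty, i.e. $W$ cannot be extended to a square-free word by inserting a single letter at any inner position (only possibly at the beginning or at the end). -}

module Defs where

open import Data.Fin using (Fin)
open import Data.List using (List; []; _∷_; _++_)
open import Data.Product using (∃-syntax; _×_)
open import Data.Sum using (_⊎_)
open import Relation.Nullary using (¬_)
open import Relation.Binary.PropositionalEquality using (_≡_)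

Word : Set → Set
Word A = List A

HasSquare : {A : Set} → Word A → Set
HasSquare {A} w = ∃[ u ] ∃[ X ] ∃[ v ] (¬ (X ≡ []) × (w ≡ u ++ X ++ X ++ v))

SquareFree : {A : Set} → Word A → Set
SquareFree w = ¬ HasSquare w

NearlyExtremal : {A : Set} → Word A → Set
NearlyExtremal {A} W =
  SquareFree W ×
  ((W' W'' : Word A) (x : A) → W ≡ W' ++ W'' →
     SquareFree (W' ++ x ∷ W'') → (W' ≡ []) ⊎ (W'' ≡ []))

𝔸₃ : Set
𝔸₃ = Fin 3

module Submission where

-- The 35-uniform morphism hM is square-free. Since no image hM c occurs inside
-- hM a ++ hM b at an offset strictly between 0 and 35, a square in hM* w of
-- period at least 69 has a period divisible by 35, and comparing the letters at
-- position 15 of corresponding blocks (which determine the block) pulls it back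
-- to a square in w; a shorter square lies in the image of a factor of w of length
-- at most 5, which is ruled out by exhaustive check. Iterating hM from 𝟎 yields
-- arbitrarily long square-free words w beginning with hM 𝟎. In W, the word
-- hM* w with its first 7 letters removed, an inner insertion lands either in the
-- fixed prefix coming from the first 5 letters of hM 𝟎, or in the image hM* t
-- of some factor t of length 3 of w, past its first block; in both cases a
-- finite table of certificates exhibits a square.

open import Defs
open import Data.Nat
  using (ℕ; zero; suc; _+_; _*_; _∸_; _≤_; _<_; _<?_; _≤?_; z≤n; s≤s; _⊓_; _/_; _%_; NonZero; >-nonZero)
open import Data.Nat.Properties
open import Data.Nat.DivMod using (m≡m%n+[m/n]*n; m%n<n; m≥n⇒m/n>0; /-monoˡ-≤; m<n*o⇒m/o<n; m*n/n≡m)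
open import Data.Nat.Tactic.RingSolver using (solve-∀)
open import Data.Fin using (zero; suc)
open import Data.Fin.Properties using (all?) renaming (_≟_ to _≟ᶠ_)
open import Data.List using (List; []; _∷_; _++_; take; drop; length; concatMap)
open import Data.List.Properties
  using (take++drop≡id; drop-drop; length-take; length-drop; length-++; ++-assoc; ∷-injective; ++-conicalˡ;
         concatMap-++; ≡-dec)
open import Data.Maybe using (Maybe; just; nothing)
open import Data.Maybe.Properties using (just-injective) renaming (≡-dec to ≡-decᵐ)
open import Data.Bool using (Bool; true; false; T; _∧_; _∨_)
open import Data.Bool.Properties using (T-∧; T-∨)
open import Data.Unit using (tt)
open import Data.Product using (∃-syntax; _×_; _,_; proj₁; proj₂; uncurry)
open import Data.Sum using (_⊎_; inj₁; inj₂)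
open import Data.Empty using (⊥; ⊥-elim)
open import Function.Bundles using (Equivalence)
open import Level using (0ℓ)
open import Relation.Nullary using (¬_; Dec; yes; no; isYes; ¬?; _×-dec_; _→-dec_)
open import Relation.Nullary.Decidable using (map′; toWitness; fromWitness; from-yes; T?)
open import Relation.Unary using (Pred; Decidable)
open import Relation.Binary.Definitions using (DecidableEquality)
open import Relation.Binary.PropositionalEquality

private variable
  A : Set

infixl 9 _!_
_!_ : Word A → ℕ → Maybe A
[] ! _ = nothing
(a ∷ w) ! zero = just a
(a ∷ w) ! suc k = w ! k

!-++ˡ : ∀ (u v : Word A) {k} → k < length u → (u ++ v) ! k ≡ u ! k
!-++ˡ (a ∷ u) v {zero} _ = refl
!-++ˡ (a ∷ u) v {suc k} (s≤s k<u) = !-++ˡ u v k<u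

!-++ʳ : ∀ (u v : Word A) k → (u ++ v) ! (length u + k) ≡ v ! k
!-++ʳ [] v k = refl
!-++ʳ (a ∷ u) v k = !-++ʳ u v k

!-drop : ∀ n (w : Word A) k → drop n w ! k ≡ w ! (n + k)
!-drop zero w k = refl
!-drop (suc n) [] k = refl
!-drop (suc n) (a ∷ w) k = !-drop n w k

!-take : ∀ n (w : Word A) {k} → k < n → take n w ! k ≡ w ! k
!-take (suc n) [] _ = refl
!-take (suc n) (a ∷ w) {zero} _ = refl
!-take (suc n) (a ∷ w) {suc k} (s≤s k<n) = !-take n w k<n

!-ext : ∀ (u v : Word A) → length u ≡ length v →
        (∀ k → k < length u → u ! k ≡ v ! k) → u ≡ v
!-ext [] [] _ _ = refl
!-ext (a ∷ u) (b ∷ v) eq pointwise =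
  cong₂ _∷_ (just-injective (pointwise 0 (s≤s z≤n)))
            (!-ext u v (suc-injective eq) (λ k k<u → pointwise (suc k) (s≤s k<u)))

!-just : ∀ (w : Word A) {k} → k < length w → ∃[ a ] w ! k ≡ just a
!-just (a ∷ w) {zero} _ = a , refl
!-just (a ∷ w) {suc k} (s≤s k<w) = !-just w k<w

!-just⇒< : ∀ (w : Word A) k {a} → w ! k ≡ just a → k < length w
!-just⇒< (b ∷ w) zero _ = s≤s z≤n
!-just⇒< (b ∷ w) (suc k) eq = s≤s (!-just⇒< w k eq)

!-just⇒drop : ∀ (w : Word A) s {a} → w ! s ≡ just a → drop s w ≡ a ∷ drop (suc s) w
!-just⇒drop (b ∷ w) zero refl = refl
!-just⇒drop (b ∷ w) (suc s) eq = !-just⇒drop w s eq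

length-take-≤ : ∀ n (w : Word A) → n ≤ length w → length (take n w) ≡ n
length-take-≤ n w n≤w = trans (length-take n w) (m≤n⇒m⊓n≡m n≤w)

take-drop-!-ext : ∀ (X Y : Word A) t → t + length Y ≤ length X →
                  (∀ k → k < length Y → X ! (t + k) ≡ Y ! k) → take (length Y) (drop t X) ≡ Y
take-drop-!-ext X Y t t+Y≤X agree = !-ext _ Y length-factor pointwise
  where
  Y≤drop : length Y ≤ length (drop t X)
  Y≤drop = subst (length Y ≤_) (sym (length-drop t X)) (m+n≤o⇒m≤o∸n (length Y) (subst (_≤ length X) (+-comm t _) t+Y≤X))
  length-factor : length (take (length Y) (drop t X)) ≡ length Y
  length-factor = length-take-≤ (length Y) (drop t X) Y≤drop
  pointwise : ∀ k → k < length (take (length Y) (drop t X)) → take (length Y) (drop t X) ! k ≡ Y ! k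
  pointwise k k<factor = trans (!-take (length Y) (drop t X) k<Y) (trans (!-drop t X k) (agree k k<Y))
    where
    k<Y : k < length Y
    k<Y = subst (k <_) length-factor k<factor

drop-suc : ∀ n (w : Word A) → drop 1 (drop n w) ≡ drop (suc n) w
drop-suc n w = trans (drop-drop n 1 w) (cong (λ k → drop k w) (+-comm n 1))

length-square-≥ : ∀ (X v : Word A) → length X + length X ≤ length (X ++ X ++ v)
length-square-≥ X v = subst (length X + length X ≤_) (sym (trans (length-++ X) (cong (length X +_) (length-++ X))))
                        (+-monoʳ-≤ (length X) (m≤m+n (length X) (length v)))

take-length-++ : ∀ (u v : Word A) → take (length u) (u ++ v) ≡ u
take-length-++ [] v = refl
take-length-++ (a ∷ u) v = cong (a ∷_) (take-length-++ u v)

drop-length-++ : ∀ (u v : Word A) → drop (length u) (u ++ v) ≡ v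
drop-length-++ [] v = refl
drop-length-++ (a ∷ u) v = drop-length-++ u v

drop-++ : ∀ n (u v : Word A) → n ≤ length u → drop n (u ++ v) ≡ drop n u ++ v
drop-++ zero u v _ = refl
drop-++ (suc n) (a ∷ u) v (s≤s n≤u) = drop-++ n u v n≤u

-- Squares

record SquareAt (w : Word A) (i p : ℕ) : Set where
  constructor squareAt
  field
    period>0 : 0 < p
    fits     : i + p + p ≤ length w
    repeats  : ∀ k → k < p → w ! (i + k) ≡ w ! (i + p + k)

squareAt-shift : ∀ {w : Word A} {i p} → SquareAt w i p →
                 ∀ {x} → i ≤ x → x < i + p → w ! x ≡ w ! (x + p)
squareAt-shift {w = w} {i} {p} sq {x} i≤x x<i+p = begin
  w ! x               ≡⟨ cong (w !_) i+k≡x ⟨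
  w ! (i + k)         ≡⟨ SquareAt.repeats sq k k<p ⟩
  w ! (i + p + k)     ≡⟨ cong (w !_) (trans (+-assoc i p k) (trans (cong (i +_) (+-comm p k)) (sym (+-assoc i k p)))) ⟩
  w ! (i + k + p)     ≡⟨ cong (λ y → w ! (y + p)) i+k≡x ⟩
  w ! (x + p)         ∎
  where
  open ≡-Reasoning
  k = x ∸ i
  i+k≡x : i + k ≡ x
  i+k≡x = m+[n∸m]≡n i≤x
  k<p : k < p
  k<p = +-cancelˡ-< i k p (subst (_< i + p) (sym i+k≡x) x<i+p)

nonEmpty⇒length>0 : ∀ (X : Word A) → ¬ (X ≡ []) → 0 < length X
nonEmpty⇒length>0 [] X≢[] = ⊥-elim (X≢[] refl)
nonEmpty⇒length>0 (_ ∷ _) _ = s≤s z≤n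

hasSquare⇒squareAt : ∀ (w : Word A) → HasSquare w → ∃[ i ] ∃[ p ] SquareAt w i p
hasSquare⇒squareAt w (u , X , v , X≢[] , refl) =
  length u , length X , squareAt (nonEmpty⇒length>0 X X≢[]) fits repeats
  where
  open ≡-Reasoning
  fits : length u + length X + length X ≤ length (u ++ X ++ X ++ v)
  fits = subst₂ _≤_ (sym (+-assoc (length u) _ _)) (sym (length-++ u))
           (+-monoʳ-≤ (length u) (length-square-≥ X v))
  repeats : ∀ k → k < length X →
            (u ++ X ++ X ++ v) ! (length u + k) ≡ (u ++ X ++ X ++ v) ! (length u + length X + k)
  repeats k k<X = begin
    (u ++ X ++ X ++ v) ! (length u + k)              ≡⟨ !-++ʳ u _ k ⟩
    (X ++ X ++ v) ! k                                ≡⟨ !-++ˡ X _ k<X ⟩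
    X ! k                                            ≡⟨ !-++ˡ X _ k<X ⟨
    (X ++ v) ! k                                     ≡⟨ !-++ʳ X _ k ⟨
    (X ++ X ++ v) ! (length X + k)                   ≡⟨ !-++ʳ u _ (length X + k) ⟨
    (u ++ X ++ X ++ v) ! (length u + (length X + k)) ≡⟨ cong ((u ++ X ++ X ++ v) !_) (+-assoc (length u) _ k) ⟨
    (u ++ X ++ X ++ v) ! (length u + length X + k)   ∎

squareFree-[_] : ∀ (a : A) → SquareFree (a ∷ [])
squareFree-[ a ] sq with hasSquare⇒squareAt (a ∷ []) sq
... | i , suc p , squareAt _ fits _ = 1+n≰n (≤-trans 2≤ fits)
  where
  2≤ : 2 ≤ i + suc p + suc p
  2≤ = +-mono-≤ (≤-trans (s≤s z≤n) (m≤n+m (suc p) i)) (s≤s z≤n)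

squareAt⇒hasSquare : ∀ (w : Word A) {i p} → SquareAt w i p → HasSquare w
squareAt⇒hasSquare w {i} {p} (squareAt p>0 fits repeats) =
  take i w , X , drop p (drop p s) , X≢[] , w≡
  where
  open ≡-Reasoning
  s = drop i w
  X = take p s
  p+p≤s : p + p ≤ length s
  p+p≤s = subst (p + p ≤_) (sym (length-drop i w))
                (m+n≤o⇒m≤o∸n (p + p) (subst (_≤ length w) (trans (+-assoc i p p) (+-comm i (p + p))) fits))
  p≤s : p ≤ length s
  p≤s = ≤-trans (m≤m+n p p) p+p≤s
  p≤drop-p-s : p ≤ length (drop p s)
  p≤drop-p-s = subst (p ≤_) (sym (length-drop p s)) (m+n≤o⇒m≤o∸n p p+p≤s)
  length-X : length X ≡ p
  length-X = length-take-≤ p s p≤s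
  X≢[] : ¬ (X ≡ [])
  X≢[] X≡[] = <-irrefl (trans (cong length (sym X≡[])) length-X) p>0
  Y≡X : take p (drop p s) ≡ X
  Y≡X = !-ext _ _ (trans (length-take-≤ p (drop p s) p≤drop-p-s) (sym length-X)) agree
    where
    agree : ∀ k → k < length (take p (drop p s)) → take p (drop p s) ! k ≡ X ! k
    agree k k<Y = begin
      take p (drop p s) ! k ≡⟨ !-take p _ k<p ⟩
      drop p s ! k          ≡⟨ !-drop p s k ⟩
      s ! (p + k)           ≡⟨ !-drop i w (p + k) ⟩
      w ! (i + (p + k))     ≡⟨ cong (w !_) (+-assoc i p k) ⟨
      w ! (i + p + k)       ≡⟨ repeats k k<p ⟨
      w ! (i + k)           ≡⟨ !-drop i w k ⟨
      s ! k                 ≡⟨ !-take p s k<p ⟨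
      X ! k                 ∎
      where
      k<p : k < p
      k<p = subst (k <_) (length-take-≤ p (drop p s) p≤drop-p-s) k<Y
  w≡ : w ≡ take i w ++ X ++ X ++ drop p (drop p s)
  w≡ = begin
    w                                                   ≡⟨ take++drop≡id i w ⟨
    take i w ++ s                                       ≡⟨ cong (take i w ++_) (take++drop≡id p s) ⟨
    take i w ++ X ++ drop p s                           ≡⟨ cong (λ z → take i w ++ X ++ z) (take++drop≡id p (drop p s)) ⟨
    take i w ++ X ++ take p (drop p s) ++ drop p (drop p s) ≡⟨ cong (λ Y → take i w ++ X ++ Y ++ drop p (drop p s)) Y≡X ⟩
    take i w ++ X ++ X ++ drop p (drop p s)             ∎

hasSquare-++ˡ : ∀ (u w : Word A) → HasSquare w → HasSquare (u ++ w)
hasSquare-++ˡ u w (v , X , v′ , X≢[] , refl) = u ++ v , X , v′ , X≢[] , sym (++-assoc u v _)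

hasSquare-++ʳ : ∀ (w u : Word A) → HasSquare w → HasSquare (w ++ u)
hasSquare-++ʳ w u (v , X , v′ , X≢[] , refl) = v , X , v′ ++ u , X≢[] , eq
  where
  eq : (v ++ X ++ X ++ v′) ++ u ≡ v ++ X ++ X ++ v′ ++ u
  eq = trans (++-assoc v _ u) (cong (v ++_) (trans (++-assoc X _ u) (cong (X ++_) (++-assoc X v′ u))))

hasSquare-infix : ∀ (u w v : Word A) → HasSquare w → HasSquare (u ++ w ++ v)
hasSquare-infix u w v sq = hasSquare-++ˡ u (w ++ v) (hasSquare-++ʳ w v sq)

hasSquare-drop : ∀ n (w : Word A) → HasSquare (drop n w) → HasSquare w
hasSquare-drop n w sq = subst HasSquare (take++drop≡id n w) (hasSquare-++ˡ (take n w) _ sq)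

squareFree-drop : ∀ n (w : Word A) → SquareFree w → SquareFree (drop n w)
squareFree-drop n w sf sq = sf (hasSquare-drop n w sq)

squareFree-take : ∀ n (w : Word A) → SquareFree w → SquareFree (take n w)
squareFree-take n w sf sq = sf (subst HasSquare (take++drop≡id n w) (hasSquare-++ʳ _ (drop n w) sq))

squareAt-restrict : ∀ (u v : Word A) o {c p} →
                    (∀ m → m < length u → u ! m ≡ v ! (o + m)) →
                    c + p + p ≤ length u → SquareAt v (o + c) p → SquareAt u c p
squareAt-restrict u v o {c} {p} agree fits (squareAt p>0 _ repeats) = squareAt p>0 fits repeats′
  where
  open ≡-Reasoning
  repeats′ : ∀ k → k < p → u ! (c + k) ≡ u ! (c + p + k)
  repeats′ k k<p = begin
    u ! (c + k)           ≡⟨ agree (c + k) c+k<u ⟩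
    v ! (o + (c + k))     ≡⟨ cong (v !_) (+-assoc o c k) ⟨
    v ! (o + c + k)       ≡⟨ repeats k k<p ⟩
    v ! (o + c + p + k)   ≡⟨ cong (v !_) (reassoc o c p k) ⟩
    v ! (o + (c + p + k)) ≡⟨ agree (c + p + k) c+p+k<u ⟨
    u ! (c + p + k)       ∎
    where
    reassoc : ∀ o c p k → o + c + p + k ≡ o + (c + p + k)
    reassoc = solve-∀
    c+p+k<u : c + p + k < length u
    c+p+k<u = <-≤-trans (+-monoʳ-< (c + p) k<p) fits
    c+k<u : c + k < length u
    c+k<u = ≤-<-trans (+-monoˡ-≤ k (m≤m+n c p)) c+p+k<u

insertAt : Word A → ℕ → A → Word A
insertAt u e x = take e u ++ x ∷ drop e u

extension-in-prefix : ∀ (U S W′ W″ : Word A) x → W′ ++ W″ ≡ U ++ S → length W′ ≤ length U →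
                      W′ ++ x ∷ W″ ≡ insertAt U (length W′) x ++ S
extension-in-prefix U S [] W″ x eq _ = cong (x ∷_) eq
extension-in-prefix (b ∷ U) S (a ∷ W′) W″ x eq (s≤s W′≤U) with ∷-injective eq
... | refl , eq′ = cong (a ∷_) (extension-in-prefix U S W′ W″ x eq′ W′≤U)

extension-in-factor : ∀ (P U S W′ W″ : Word A) x → W′ ++ W″ ≡ P ++ U ++ S →
                      length P ≤ length W′ → length W′ ≤ length P + length U →
                      W′ ++ x ∷ W″ ≡ P ++ insertAt U (length W′ ∸ length P) x ++ S
extension-in-factor [] U S W′ W″ x eq _ W′≤U = extension-in-prefix U S W′ W″ x eq W′≤U
extension-in-factor (b ∷ P) U S (a ∷ W′) W″ x eq (s≤s P≤W′) (s≤s W′≤PU) with ∷-injective eq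
... | refl , eq′ = cong (a ∷_) (extension-in-factor P U S W′ W″ x eq′ P≤W′ W′≤PU)

-- Deciding square-freeness

module SquareFreeDecision (_≟_ : DecidableEquality A) where

  private
    _≟ʷ_ : DecidableEquality (Word A)
    _≟ʷ_ = ≡-dec _≟_

  -- With r = drop p w, tests the periods p, p + 1, … of a square prefix of w;
  -- walking down r instead of recomputing drop keeps the test quadratic.
  squarePrefixFromᵇ : ℕ → Word A → Word A → Bool
  squarePrefixFromᵇ p w [] = false
  squarePrefixFromᵇ p w r@(_ ∷ r′) = isYes (take p w ≟ʷ take p r) ∨ squarePrefixFromᵇ (suc p) w r′

  squarePrefix : ∀ p (w r : Word A) → r ≡ drop (suc p) w → ¬ (r ≡ []) →
                 take (suc p) w ≡ take (suc p) r → HasSquare w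
  squarePrefix p w [] _ []≢[] _ = ⊥-elim ([]≢[] refl)
  squarePrefix p w r@(b ∷ _) r≡ _ X≡Y = [] , X , drop (suc p) r , X≢[] , w≡
    where
    open ≡-Reasoning
    X = take (suc p) w
    X≢[] : ¬ (X ≡ [])
    X≢[] X≡[] with trans (sym X≡Y) X≡[]
    ... | ()
    w≡ : w ≡ X ++ X ++ drop (suc p) r
    w≡ = begin
      w                                            ≡⟨ take++drop≡id (suc p) w ⟨
      X ++ drop (suc p) w                          ≡⟨ cong (X ++_) r≡ ⟨
      X ++ r                                       ≡⟨ cong (X ++_) (take++drop≡id (suc p) r) ⟨
      X ++ take (suc p) r ++ drop (suc p) r        ≡⟨ cong (λ Y → X ++ Y ++ drop (suc p) r) X≡Y ⟨
      X ++ X ++ drop (suc p) r                     ∎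

  squarePrefixFromᵇ-sound : ∀ p (w r : Word A) → r ≡ drop (suc p) w →
                            T (squarePrefixFromᵇ (suc p) w r) → HasSquare w
  squarePrefixFromᵇ-sound p w r@(_ ∷ r′) r≡ t with Equivalence.to (T-∨ {isYes (take (suc p) w ≟ʷ take (suc p) r)}) t
  ... | inj₁ found = squarePrefix p w r r≡ (λ ()) (toWitness found)
  ... | inj₂ later = squarePrefixFromᵇ-sound (suc p) w r′ (trans (cong (drop 1) r≡) (drop-suc (suc p) w)) later

  squarePrefixFromᵇ-complete : ∀ (X v : Word A) p r → r ≡ drop p (X ++ X ++ v) → 0 < p → p ≤ length X →
                               T (squarePrefixFromᵇ p (X ++ X ++ v) r)
  squarePrefixFromᵇ-complete X v p [] r≡ 0<p p≤X = <⇒≱ p<w w≤p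
    where
    w≤p : length (X ++ X ++ v) ≤ p
    w≤p = m∸n≡0⇒m≤n (sym (trans (cong length r≡) (length-drop p _)))
    p<w : p < length (X ++ X ++ v)
    p<w = ≤-trans (subst (_≤ length X + length X) (+-comm p 1) (+-mono-≤ p≤X (≤-trans 0<p p≤X)))
                  (length-square-≥ X v)
  squarePrefixFromᵇ-complete X v p r@(_ ∷ r′) r≡ 0<p p≤X with m≤n⇒m<n∨m≡n p≤X
  ... | inj₂ refl = Equivalence.from (T-∨ {isYes (take (length X) (X ++ X ++ v) ≟ʷ take (length X) r)})
                      (inj₁ (fromWitness (trans (take-length-++ X _) (sym Y≡X))))
    where
    Y≡X : take (length X) r ≡ X
    Y≡X = trans (cong (take (length X)) (trans r≡ (drop-length-++ X _))) (take-length-++ X v)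
  ... | inj₁ p<X = Equivalence.from (T-∨ {isYes (take p (X ++ X ++ v) ≟ʷ take p r)})
                     (inj₂ (squarePrefixFromᵇ-complete X v (suc p) r′ (trans (cong (drop 1) r≡) (drop-suc p _)) (s≤s z≤n) p<X))

  squareAtᵇ : Word A → ℕ × ℕ → Bool
  squareAtᵇ w (i , p) = squarePrefixFromᵇ (suc p) (drop i w) (drop (suc p) (drop i w))

  squareAtᵇ-sound : ∀ (w : Word A) c → T (squareAtᵇ w c) → HasSquare w
  squareAtᵇ-sound w (i , p) t = hasSquare-drop i w (squarePrefixFromᵇ-sound p (drop i w) _ refl t)

  squareFree? : (w : Word A) → Dec (SquareFree w)
  squareFree? [] = yes λ { ([] , X , _ , X≢[] , eq) → X≢[] (++-conicalˡ X _ (sym eq)) }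
  squareFree? w@(a ∷ s) = map′ (uncurry combine) split (¬? (T? (squarePrefixFromᵇ 1 w s)) ×-dec squareFree? s)
    where
    NoSquarePrefix : Set
    NoSquarePrefix = ¬ T (squarePrefixFromᵇ 1 w s)
    combine : NoSquarePrefix → SquareFree s → SquareFree w
    combine _ _ ([] , [] , _ , []≢[] , _) = []≢[] refl
    combine noPrefix _ ([] , X@(_ ∷ _) , v , _ , refl) =
      noPrefix (squarePrefixFromᵇ-complete X v 1 s refl (s≤s z≤n) (s≤s z≤n))
    combine _ sf-s (b ∷ u , X , v , X≢[] , eq) with ∷-injective eq
    ... | refl , eq′ = sf-s (u , X , v , X≢[] , eq′)
    split : SquareFree w → NoSquarePrefix × SquareFree s
    split sf = (λ t → sf (squarePrefixFromᵇ-sound 0 w s refl t)) ,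
               (λ sq → sf (hasSquare-++ˡ (a ∷ []) s sq))

module _ (all? : ∀ {P : Pred A 0ℓ} → Decidable P → Dec (∀ a → P a)) where

  allWordsUpTo? : ∀ {P : Pred (Word A) 0ℓ} → Decidable P → ∀ n → Dec (∀ w → length w ≤ n → P w)
  allWordsUpTo? P? zero = map′ (λ { P[] [] _ → P[] }) (λ all-w → all-w [] z≤n) (P? [])
  allWordsUpTo? {P} P? (suc n) = map′ (uncurry extend) restrict
    (P? [] ×-dec all? (λ a → allWordsUpTo? (λ w → P? (a ∷ w)) n))
    where
    AllExtensions : Set
    AllExtensions = ∀ a w → length w ≤ n → P (a ∷ w)
    extend : P [] → AllExtensions → ∀ w → length w ≤ suc n → P w
    extend P[] _ [] _ = P[]
    extend _ all-a (a ∷ w) (s≤s w≤n) = all-a a w w≤n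
    restrict : (∀ w → length w ≤ suc n → P w) → P [] × AllExtensions
    restrict all-w = all-w [] z≤n , λ a w w≤n → all-w (a ∷ w) (s≤s w≤n)

-- Uniform morphisms

module UniformMorphism {A : Set} (h : A → Word A) {L : ℕ} (h-uniform : ∀ a → length (h a) ≡ L) where

  h* : Word A → Word A
  h* = concatMap h

  length-h* : ∀ w → length (h* w) ≡ length w * L
  length-h* [] = refl
  length-h* (a ∷ w) = trans (length-++ (h a)) (cong₂ _+_ (h-uniform a) (length-h* w))

  !-h*-drop : ∀ w s m → s ≤ length w → h* w ! (s * L + m) ≡ h* (drop s w) ! m
  !-h*-drop w s m s≤w = begin
    h* w ! (s * L + m)                                 ≡⟨ cong (λ v → h* v ! (s * L + m)) (take++drop≡id s w) ⟨
    h* (take s w ++ drop s w) ! (s * L + m)            ≡⟨ cong (_! (s * L + m)) (concatMap-++ h (take s w) _) ⟩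
    (h* (take s w) ++ h* (drop s w)) ! (s * L + m)     ≡⟨ cong (λ n → (h* (take s w) ++ h* (drop s w)) ! (n + m)) length-prefix ⟨
    (h* (take s w) ++ h* (drop s w)) ! (length (h* (take s w)) + m) ≡⟨ !-++ʳ (h* (take s w)) _ m ⟩
    h* (drop s w) ! m                                  ∎
    where
    open ≡-Reasoning
    length-prefix : length (h* (take s w)) ≡ s * L
    length-prefix = trans (length-h* (take s w)) (cong (_* L) (length-take-≤ s w s≤w))

  !-h*-window : ∀ w s n m → s + n ≤ length w → m < n * L →
                h* w ! (s * L + m) ≡ h* (take n (drop s w)) ! m
  !-h*-window w s n m s+n≤w m<nL = begin
    h* w ! (s * L + m)                         ≡⟨ !-h*-drop w s m (≤-trans (m≤m+n s n) s+n≤w) ⟩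
    h* (drop s w) ! m                          ≡⟨ cong (λ v → h* v ! m) (take++drop≡id n (drop s w)) ⟨
    h* (take n (drop s w) ++ drop n (drop s w)) ! m  ≡⟨ cong (_! m) (concatMap-++ h (take n (drop s w)) _) ⟩
    (h* (take n (drop s w)) ++ h* (drop n (drop s w))) ! m ≡⟨ !-++ˡ (h* (take n (drop s w))) _ m<window ⟩
    h* (take n (drop s w)) ! m                 ∎
    where
    open ≡-Reasoning
    n≤drop : n ≤ length (drop s w)
    n≤drop = subst (n ≤_) (sym (length-drop s w)) (m+n≤o⇒m≤o∸n n (subst (_≤ length w) (+-comm s n) s+n≤w))
    m<window : m < length (h* (take n (drop s w)))
    m<window = subst (m <_) (sym (trans (length-h* (take n (drop s w))) (cong (_* L) (length-take-≤ n (drop s w) n≤drop)))) m<nL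

  !-h*-block : ∀ w q {a} r → w ! q ≡ just a → r < L → h* w ! (q * L + r) ≡ h a ! r
  !-h*-block w q {a} r w!q r<L = begin
    h* w ! (q * L + r)                  ≡⟨ !-h*-drop w q r (<⇒≤ (!-just⇒< w q w!q)) ⟩
    h* (drop q w) ! r                   ≡⟨ cong (λ v → h* v ! r) (!-just⇒drop w q w!q) ⟩
    (h a ++ h* (drop (suc q) w)) ! r    ≡⟨ !-++ˡ (h a) _ (subst (r <_) (sym (h-uniform a)) r<L) ⟩
    h a ! r                             ∎
    where open ≡-Reasoning

  !-h*-pair : ∀ w s {a b} m → w ! s ≡ just a → w ! suc s ≡ just b → m < L + L →
              h* w ! (s * L + m) ≡ (h a ++ h b) ! m
  !-h*-pair w s {a} {b} m w!s w!s+1 m<2L = begin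
    h* w ! (s * L + m)                                    ≡⟨ !-h*-drop w s m (<⇒≤ (!-just⇒< w s w!s)) ⟩
    h* (drop s w) ! m                                     ≡⟨ cong (λ v → h* v ! m) drop-s ⟩
    (h a ++ h b ++ h* (drop (suc (suc s)) w)) ! m         ≡⟨ cong (_! m) (++-assoc (h a) (h b) _) ⟨
    ((h a ++ h b) ++ h* (drop (suc (suc s)) w)) ! m       ≡⟨ !-++ˡ (h a ++ h b) _ m<ab ⟩
    (h a ++ h b) ! m                                      ∎
    where
    open ≡-Reasoning
    drop-s : drop s w ≡ a ∷ b ∷ drop (suc (suc s)) w
    drop-s = trans (!-just⇒drop w s w!s) (cong (a ∷_) (!-just⇒drop w (suc s) w!s+1))
    m<ab : m < length (h a ++ h b)
    m<ab = subst (m <_) (sym (trans (length-++ (h a)) (cong₂ _+_ (h-uniform a) (h-uniform b)))) m<2L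

  module SquareFreeness
    {d : ℕ} (d<L : d < L)
    (marker : ∀ a b → h a ! d ≡ h b ! d → a ≡ b)
    (synchronising : ∀ a b c t → 0 < t → t < L → ¬ (take L (drop t (h a ++ h b)) ≡ h c))
    (short-images : ∀ u → length u ≤ 5 → SquareFree u → SquareFree (h* u))
    where

    L>0 : 0 < L
    L>0 = ≤-<-trans z≤n d<L

    instance
      L-nonZero : NonZero L
      L-nonZero = >-nonZero L>0

    position-in-window : ∀ i e → e < L → ∃[ q ] (i ≤ q * L + e × q * L + e < i + L)
    position-in-window zero e e<L = 0 , z≤n , e<L
    position-in-window (suc i) e e<L with position-in-window i e e<L
    ... | q , i≤ , <i+L with m≤n⇒m<n∨m≡n i≤
    ...   | inj₁ i< = q , i< , m<n⇒m<1+n <i+L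
    ...   | inj₂ i≡ = suc q , subst (suc i ≤_) (sym next≡) (+-monoˡ-≤ i L>0) ,
                              subst (_< suc i + L) (sym next≡) (subst (L + i <_) (cong suc (+-comm L i)) (n<1+n (L + i)))
      where
      next≡ : suc q * L + e ≡ L + i
      next≡ = trans (+-assoc L (q * L) e) (cong (L +_) (sym i≡))

    -- A square of period below 2L - 1 starting in block s fits in the blocks s, …, s + 4.
    shortSquare⇒⊥ : ∀ w {i p} → SquareFree w → SquareAt (h* w) i p → suc p < L + L → ⊥
    shortSquare⇒⊥ w {i} {p} sf sq 1+p<2L =
      short-images u (subst (_≤ 5) (sym (length-take-≤ n _ n≤drop)) (m⊓n≤m 5 _)) (squareFree-take n _ (squareFree-drop s w sf))
        (squareAt⇒hasSquare (h* u) (squareAt-restrict (h* u) (h* w) (s * L) agree fits-u sq′))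
      where
      s = i / L
      c = i % L
      n = 5 ⊓ (length w ∸ s)
      u = take n (drop s w)
      i≡ : i ≡ s * L + c
      i≡ = trans (m≡m%n+[m/n]*n i L) (+-comm c (s * L))
      sq′ : SquareAt (h* w) (s * L + c) p
      sq′ = subst (λ j → SquareAt (h* w) j p) i≡ sq
      fits-w : s * L + (c + p + p) ≤ length w * L
      fits-w = subst₂ _≤_ (reassoc (s * L) c p) (length-h* w) (SquareAt.fits sq′)
        where reassoc : ∀ a b c → a + b + c + c ≡ a + (b + c + c)
              reassoc = solve-∀
      s≤w : s ≤ length w
      s≤w = *-cancelʳ-≤ s (length w) L (≤-trans (m≤m+n (s * L) _) fits-w)
      n≤drop : n ≤ length (drop s w)
      n≤drop = subst (n ≤_) (sym (length-drop s w)) (m⊓n≤n 5 _)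
      s+n≤w : s + n ≤ length w
      s+n≤w = ≤-trans (+-monoʳ-≤ s (m⊓n≤n 5 _)) (≤-reflexive (m+[n∸m]≡n s≤w))
      c+2p≤nL : c + p + p ≤ n * L
      c+2p≤nL = subst (c + p + p ≤_) (sym (*-distribʳ-⊓ L 5 (length w ∸ s))) (⊓-glb c+2p≤5L c+2p≤rest)
        where
        p<2L : p < L + L
        p<2L = <-trans (n<1+n p) 1+p<2L
        five : ∀ L → L + (L + L) + (L + L) ≡ 5 * L
        five = solve-∀
        c+2p≤5L : c + p + p ≤ 5 * L
        c+2p≤5L = <⇒≤ (subst (c + p + p <_) (five L) (+-mono-< (+-mono-< (m%n<n i L) p<2L) p<2L))
        c+2p≤rest : c + p + p ≤ (length w ∸ s) * L
        c+2p≤rest = subst (c + p + p ≤_) (sym (*-distribʳ-∸ L (length w) s))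
                      (m+n≤o⇒m≤o∸n (c + p + p) (subst (_≤ length w * L) (+-comm (s * L) _) fits-w))
      fits-u : c + p + p ≤ length (h* u)
      fits-u = subst (c + p + p ≤_) (sym (trans (length-h* u) (cong (_* L) (length-take-≤ n _ n≤drop)))) c+2p≤nL
      agree : ∀ m → m < length (h* u) → h* u ! m ≡ h* w ! (s * L + m)
      agree m m<u = sym (!-h*-window w s n m s+n≤w
                          (subst (m <_) (trans (length-h* u) (cong (_* L) (length-take-≤ n _ n≤drop))) m<u))

    misaligned-block⇒⊥ : ∀ w s t c → suc s < length w → 0 < t → t < L →
                         (∀ k → k < L → h* w ! (s * L + t + k) ≡ h c ! k) → ⊥
    misaligned-block⇒⊥ w s t c s+1<w 0<t t<L occurs = synchronising a b c t 0<t t<L factor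
      where
      w!s : ∃[ x ] w ! s ≡ just x
      w!s = !-just w (<-trans (n<1+n s) s+1<w)
      w!s+1 : ∃[ x ] w ! suc s ≡ just x
      w!s+1 = !-just w s+1<w
      a = proj₁ w!s
      b = proj₁ w!s+1
      pointwise : ∀ k → k < length (h c) → (h a ++ h b) ! (t + k) ≡ h c ! k
      pointwise k k<c = begin
        (h a ++ h b) ! (t + k)   ≡⟨ !-h*-pair w s (t + k) (proj₂ w!s) (proj₂ w!s+1) (+-mono-< t<L k<L) ⟨
        h* w ! (s * L + (t + k)) ≡⟨ cong (h* w !_) (+-assoc (s * L) t k) ⟨
        h* w ! (s * L + t + k)   ≡⟨ occurs k k<L ⟩
        h c ! k                  ∎
        where
        open ≡-Reasoning
        k<L : k < L
        k<L = subst (k <_) (h-uniform c) k<c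
      factor : take L (drop t (h a ++ h b)) ≡ h c
      factor = subst (λ n → take n (drop t (h a ++ h b)) ≡ h c) (h-uniform c)
                 (take-drop-!-ext (h a ++ h b) (h c) t bound pointwise)
        where
        bound : t + length (h c) ≤ length (h a ++ h b)
        bound = subst₂ _≤_ (cong (t +_) (sym (h-uniform c))) (sym (trans (length-++ (h a)) (cong₂ _+_ (h-uniform a) (h-uniform b))))
                  (+-monoˡ-≤ L (<⇒≤ t<L))

    -- The block g beginning at the first boundary g * L ≥ i lies in the first half of
    -- the square, so it reappears at offset p % L inside the blocks s, s + 1.
    longSquare-period : ∀ w {i p} → SquareAt (h* w) i p → L + L ≤ suc p → p % L ≡ 0
    longSquare-period w {i} {p} sq 2L≤1+p with p % L in p%L≡ | position-in-window i 0 L>0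
    ... | zero   | _ = refl
    ... | suc t′ | g , i≤gL+0 , gL+0<i+L = ⊥-elim (misaligned-block⇒⊥ w s t c s+1<w (s≤s z≤n) t<L reappears)
      where
      t = suc t′
      r = p / L
      s = g + r
      t<L : t < L
      t<L = subst (_< L) p%L≡ (m%n<n p L)
      i≤gL : i ≤ g * L
      i≤gL = subst (i ≤_) (+-identityʳ (g * L)) i≤gL+0
      gL<i+L : g * L < i + L
      gL<i+L = subst (_< i + L) (+-identityʳ (g * L)) gL+0<i+L
      block-in-first-half : g * L + L ≤ i + p
      block-in-first-half = ≤-pred (<-≤-trans (+-monoˡ-< L gL<i+L)
        (subst (_≤ suc (i + p)) (sym (+-assoc i L L)) (subst (i + (L + L) ≤_) (+-suc i p) (+-monoʳ-≤ i 2L≤1+p))))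
      fits : i + p + p ≤ length w * L
      fits = subst (i + p + p ≤_) (length-h* w) (SquareAt.fits sq)
      g<w : g < length w
      g<w = *-cancelʳ-≤ (suc g) (length w) L
              (≤-trans (subst (_≤ i + p) (+-comm (g * L) L) block-in-first-half) (≤-trans (m≤m+n (i + p) p) fits))
      gL+p≡ : g * L + p ≡ s * L + t
      gL+p≡ = trans (cong (g * L +_) (trans (m≡m%n+[m/n]*n p L) (cong (_+ r * L) p%L≡))) (reassoc g r L t)
        where reassoc : ∀ g r L t → g * L + (t + r * L) ≡ (g + r) * L + t
              reassoc = solve-∀
      s+1<w : suc s < length w
      s+1<w = *-cancelʳ-< L (suc s) (length w) (<-≤-trans sL+L<gL+p+L (≤-trans gL+p+L≤ fits))
        where
        sL+L<gL+p+L : suc s * L < g * L + p + L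
        sL+L<gL+p+L = subst (λ x → suc s * L < x + L) (sym gL+p≡)
                        (subst (_< s * L + t + L) (+-comm (s * L) L) (+-monoˡ-< L (m<m+n (s * L) (s≤s z≤n))))
        gL+p+L≤ : g * L + p + L ≤ i + p + p
        gL+p+L≤ = subst (_≤ i + p + p) (swap (g * L) L p) (+-monoˡ-≤ p block-in-first-half)
          where swap : ∀ a b c → a + b + c ≡ a + c + b
                swap = solve-∀
      w!g : ∃[ x ] w ! g ≡ just x
      w!g = !-just w g<w
      c = proj₁ w!g
      reappears : ∀ k → k < L → h* w ! (s * L + t + k) ≡ h c ! k
      reappears k k<L = begin
        h* w ! (s * L + t + k)   ≡⟨ cong (λ x → h* w ! (x + k)) gL+p≡ ⟨
        h* w ! (g * L + p + k)   ≡⟨ cong (h* w !_) (trans (+-assoc (g * L) p k) (trans (cong (g * L +_) (+-comm p k)) (sym (+-assoc (g * L) k p)))) ⟩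
        h* w ! (g * L + k + p)   ≡⟨ squareAt-shift sq (≤-trans i≤gL (m≤m+n _ k)) (<-≤-trans (+-monoʳ-< (g * L) k<L) block-in-first-half) ⟨
        h* w ! (g * L + k)       ≡⟨ !-h*-block w g k (proj₂ w!g) k<L ⟩
        h c ! k                  ∎
        where open ≡-Reasoning

    !-h*-marker : ∀ w x y → x < length w → y < length w →
                  h* w ! (x * L + d) ≡ h* w ! (y * L + d) → w ! x ≡ w ! y
    !-h*-marker w x y x<w y<w eq = trans (proj₂ w!x) (trans (cong just (marker _ _ markers)) (sym (proj₂ w!y)))
      where
      w!x : ∃[ a ] w ! x ≡ just a
      w!x = !-just w x<w
      w!y : ∃[ b ] w ! y ≡ just b
      w!y = !-just w y<w
      markers : h (proj₁ w!x) ! d ≡ h (proj₁ w!y) ! d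
      markers = trans (sym (!-h*-block w x d (proj₂ w!x) d<L)) (trans eq (!-h*-block w y d (proj₂ w!y) d<L))

    alignedSquare⇒square : ∀ w {i r} → SquareAt (h* w) i (r * L) → 0 < r → HasSquare w
    alignedSquare⇒square w {i} {r} sq r>0 with position-in-window i d d<L
    ... | q , i≤qL+d , qL+d<i+L = squareAt⇒hasSquare w (squareAt r>0 fits repeats)
      where
      p = r * L
      fits : q + r + r ≤ length w
      fits = ≤-pred (*-cancelʳ-< L (q + r + r) (suc (length w)) (subst (_< suc (length w) * L) (sym expand) bound))
        where
        expand : (q + r + r) * L ≡ q * L + p + p
        expand = distrib q r L
          where distrib : ∀ q r L → (q + r + r) * L ≡ q * L + r * L + r * L
                distrib = solve-∀
        bound : q * L + p + p < suc (length w) * L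
        bound = subst (q * L + p + p <_) (+-comm (length w * L) L)
                  (<-≤-trans (+-monoˡ-< p (+-monoˡ-< p (≤-<-trans (m≤m+n (q * L) d) qL+d<i+L)))
                    (subst (_≤ length w * L + L) (swap i L p) (+-monoˡ-≤ L (subst (i + p + p ≤_) (length-h* w) (SquareAt.fits sq)))))
          where swap : ∀ i L p → i + p + p + L ≡ i + L + p + p
                swap = solve-∀
      repeats : ∀ k → k < r → w ! (q + k) ≡ w ! (q + r + k)
      repeats k k<r = !-h*-marker w (q + k) (q + r + k) q+k<w q+r+k<w
                        (trans (squareAt-shift sq i≤x x<i+p) (cong (h* w !_) x+p≡))
        where
        q+r+k<w : q + r + k < length w
        q+r+k<w = <-≤-trans (+-monoʳ-< (q + r) k<r) fits
        q+k<w : q + k < length w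
        q+k<w = <-≤-trans (+-monoʳ-< q k<r) (≤-trans (m≤m+n (q + r) r) fits)
        x = (q + k) * L + d
        x≡ : x ≡ k * L + (q * L + d)
        x≡ = shuffle q k L d
          where shuffle : ∀ q k L d → (q + k) * L + d ≡ k * L + (q * L + d)
                shuffle = solve-∀
        i≤x : i ≤ x
        i≤x = subst (i ≤_) (sym x≡) (≤-trans i≤qL+d (m≤n+m _ (k * L)))
        x<i+p : x < i + p
        x<i+p = subst (_< i + p) (sym x≡) (<-≤-trans (+-monoʳ-< (k * L) qL+d<i+L)
                  (subst (_≤ i + p) (shuffle i k L) (+-monoʳ-≤ i (*-monoˡ-≤ L k<r))))
          where shuffle : ∀ i k L → i + (L + k * L) ≡ k * L + (i + L)
                shuffle = solve-∀
        x+p≡ : x + p ≡ (q + r + k) * L + d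
        x+p≡ = shuffle q k L d r
          where shuffle : ∀ q k L d r → (q + k) * L + d + r * L ≡ (q + r + k) * L + d
                shuffle = solve-∀

    h*-squareFree : ∀ w → SquareFree w → SquareFree (h* w)
    h*-squareFree w sf sq with hasSquare⇒squareAt (h* w) sq
    ... | i , p , sqAt with suc p <? L + L
    ...   | yes short-period = shortSquare⇒⊥ w sf sqAt short-period
    ...   | no ¬short-period = sf (alignedSquare⇒square w (subst (SquareAt (h* w) i) p≡ sqAt) r>0)
      where
      long-period : L + L ≤ suc p
      long-period = ≮⇒≥ ¬short-period
      p≡ : p ≡ p / L * L
      p≡ = trans (m≡m%n+[m/n]*n p L) (cong (_+ p / L * L) (longSquare-period w sqAt long-period))
      r>0 : 0 < p / L
      r>0 = m≥n⇒m/n>0 (≤-pred (subst (_≤ suc p) (+-comm L 1) (≤-trans (+-monoʳ-≤ L L>0) long-period)))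

  offset-in-window : ∀ {P s j a} → a + P ≡ s * L → s * L + L ≤ j + P → j + P < s * L + (L + L + L) →
                     a ≤ j × L ≤ j ∸ a × j ∸ a < L + L + L
  offset-in-window {P} {s} {j} {a} a+P≡sL sL+L≤J J<sL+3L = a≤j , L≤e , e<3L
    where
    open ≡-Reasoning
    a≤j : a ≤ j
    a≤j = +-cancelʳ-≤ P a j (subst (_≤ j + P) (sym a+P≡sL) (≤-trans (m≤m+n (s * L) L) sL+L≤J))
    sL+e≡J : s * L + (j ∸ a) ≡ j + P
    sL+e≡J = begin
      s * L + (j ∸ a)        ≡⟨ cong (_+ (j ∸ a)) a+P≡sL ⟨
      a + P + (j ∸ a)        ≡⟨ swap a P (j ∸ a) ⟩
      a + (j ∸ a) + P        ≡⟨ cong (_+ P) (m+[n∸m]≡n a≤j) ⟩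
      j + P                  ∎
      where swap : ∀ a b c → a + b + c ≡ a + c + b
            swap = solve-∀
    L≤e : L ≤ j ∸ a
    L≤e = +-cancelˡ-≤ (s * L) L (j ∸ a) (subst (s * L + L ≤_) (sym sL+e≡J) sL+L≤J)
    e<3L : j ∸ a < L + L + L
    e<3L = +-cancelˡ-< (s * L) (j ∸ a) (L + L + L) (subst (_< s * L + (L + L + L)) (sym sL+e≡J) J<sL+3L)

  ThreeBlockWindow : ℕ → ℕ → Set
  ThreeBlockWindow J m = ∃[ s ] (1 ≤ s × s + 3 ≤ m × s * L + L ≤ J × J < s * L + (L + L + L))

  three-block-window′ : ∀ {J m b c} → c < L → J ≡ c + b * L → 2 ≤ b → b < m → 4 ≤ m → ThreeBlockWindow J m
  three-block-window′ {J} {m} {suc (suc b′)} {c} c<L refl (s≤s (s≤s _)) b<m 4≤m with suc b′ + 3 ≤? m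
  ... | yes b+2≤m = suc b′ , s≤s z≤n , b+2≤m , lower , upper
    where
    lower : suc b′ * L + L ≤ c + suc (suc b′) * L
    lower = subst (_≤ c + suc (suc b′) * L) (+-comm L _) (m≤n+m _ c)
    upper : c + suc (suc b′) * L < suc b′ * L + (L + L + L)
    upper = <-≤-trans (+-monoˡ-< _ c<L) (subst (L + (L + (L + b′ * L)) ≤_) (shuffle b′ L) (m≤m+n _ L))
      where shuffle : ∀ b L → L + (L + (L + b * L)) + L ≡ L + b * L + (L + L + L)
            shuffle = solve-∀
  ... | no ¬b+2≤m = b′ , 1≤b′ , subst (_≤ m) (+-comm 3 b′) b<m , lower , upper
    where
    1≤b′ : 1 ≤ b′
    1≤b′ = ≤-pred (≤-pred (≤-pred (≤-trans 4≤m (subst (m ≤_) (+-comm b′ 3) (≮⇒≥ ¬b+2≤m)))))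
    lower : b′ * L + L ≤ c + suc (suc b′) * L
    lower = ≤-trans (subst (b′ * L + L ≤_) (shuffle b′ L) (m≤m+n _ L)) (m≤n+m _ c)
      where shuffle : ∀ b L → b * L + L + L ≡ L + (L + b * L)
            shuffle = solve-∀
    upper : c + suc (suc b′) * L < b′ * L + (L + L + L)
    upper = subst (c + suc (suc b′) * L <_) (shuffle b′ L) (+-monoˡ-< _ c<L)
      where shuffle : ∀ b L → L + (L + (L + b * L)) ≡ b * L + (L + L + L)
            shuffle = solve-∀

  three-block-window : ∀ {J m} → .{{NonZero L}} → L + L ≤ J → J < m * L → 4 ≤ m → ThreeBlockWindow J m
  three-block-window {J} {m} 2L≤J J<mL 4≤m =
    three-block-window′ (m%n<n J L) (m≡m%n+[m/n]*n J L) 2≤J/L (m<n*o⇒m/o<n J<mL) 4≤m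
    where
    2≤J/L : 2 ≤ J / L
    2≤J/L = subst (_≤ J / L) (m*n/n≡m 2 L) (/-monoˡ-≤ L (subst (_≤ J) (cong (L +_) (sym (+-identityʳ L))) 2L≤J))

  module NearlyExtremality
    (h*-squareFree : ∀ w → SquareFree w → SquareFree (h* w))
    {a₀ : A} (h-a₀ : ∃[ r ] h a₀ ≡ a₀ ∷ r)
    {P : ℕ} (P≤L : P ≤ L) (5≤L : 5 ≤ L)
    (start-insertions : ∀ e → 0 < e → e + P < L + L → ∀ x →
                        HasSquare (insertAt (drop P (h* (take 5 (h a₀)))) e x))
    (middle-insertions : ∀ t → length t ≡ 3 → SquareFree t → ∀ e → L ≤ e → e < L + L + L → ∀ x →
                         HasSquare (insertAt (h* t) e x))
    where

    instance
      L-nonZero : NonZero L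
      L-nonZero = >-nonZero (≤-trans (s≤s z≤n) 5≤L)

    module _ (v : Word A) (sf : SquareFree (h* (a₀ ∷ v))) where

      w : Word A
      w = h* (a₀ ∷ v)
      W : Word A
      W = drop P (h* w)

      L≤w : L ≤ length w
      L≤w = subst (L ≤_) (sym (length-h* (a₀ ∷ v))) (m≤m+n L _)

      start-extension : ∀ W′ W″ x → W ≡ W′ ++ W″ → 0 < length W′ → length W′ + P < L + L →
                        HasSquare (W′ ++ x ∷ W″)
      start-extension W′ W″ x W≡ W′>0 start =
        subst HasSquare (sym split) (hasSquare-++ʳ _ R (start-insertions j W′>0 start x))
        where
        j = length W′
        A₀ = h* (take 5 (h a₀))
        R = h* (drop 5 (h a₀) ++ h* v)
        U = drop P A₀
        length-A₀ : length A₀ ≡ 5 * L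
        length-A₀ = trans (length-h* (take 5 (h a₀))) (cong (_* L) (length-take-≤ 5 (h a₀) (subst (5 ≤_) (sym (h-uniform a₀)) 5≤L)))
        2L≤A₀ : L + L ≤ length A₀
        2L≤A₀ = subst (L + L ≤_) (sym length-A₀) (subst (L + L ≤_) (five L) (m≤m+n (L + L) (L + L + L)))
          where five : ∀ L → L + L + (L + L + L) ≡ 5 * L
                five = solve-∀
        W≡U++R : W ≡ U ++ R
        W≡U++R = begin
          drop P (h* (h a₀ ++ h* v))                          ≡⟨ cong (λ y → drop P (h* (y ++ h* v))) (take++drop≡id 5 (h a₀)) ⟨
          drop P (h* ((take 5 (h a₀) ++ drop 5 (h a₀)) ++ h* v)) ≡⟨ cong (λ y → drop P (h* y)) (++-assoc (take 5 (h a₀)) _ _) ⟩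
          drop P (h* (take 5 (h a₀) ++ drop 5 (h a₀) ++ h* v))   ≡⟨ cong (drop P) (concatMap-++ h (take 5 (h a₀)) _) ⟩
          drop P (A₀ ++ R)                                       ≡⟨ drop-++ P A₀ R (≤-trans P≤L (≤-trans (m≤m+n L L) 2L≤A₀)) ⟩
          U ++ R                                                 ∎
          where open ≡-Reasoning
        j≤U : j ≤ length U
        j≤U = subst (j ≤_) (sym (length-drop P A₀)) (m+n≤o⇒m≤o∸n j (≤-trans (<⇒≤ start) 2L≤A₀))
        split : W′ ++ x ∷ W″ ≡ insertAt U j x ++ R
        split = extension-in-prefix U R W′ W″ x (trans (sym W≡) W≡U++R) j≤U

      window-extension : ∀ W′ W″ x → W ≡ W′ ++ W″ → ThreeBlockWindow (length W′ + P) (length w) →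
                         HasSquare (W′ ++ x ∷ W″)
      window-extension W′ W″ x W≡ (s , 1≤s , s+3≤w , sL+L≤J , J<sL+3L) =
        subst HasSquare (sym split) (hasSquare-infix Pre _ S (middle-insertions t length-t sf-t e L≤e e<3L x))
        where
        j = length W′
        t = take 3 (drop s w)
        rest = drop 3 (drop s w)
        Pre = drop P (h* (take s w))
        S = h* rest
        s≤w : s ≤ length w
        s≤w = ≤-trans (m≤m+n s 3) s+3≤w
        length-t : length t ≡ 3
        length-t = length-take-≤ 3 (drop s w)
          (subst (3 ≤_) (sym (length-drop s w)) (m+n≤o⇒m≤o∸n 3 (subst (_≤ length w) (+-comm s 3) s+3≤w)))
        sf-t : SquareFree t
        sf-t = squareFree-take 3 _ (squareFree-drop s w sf)
        length-prefix : length (h* (take s w)) ≡ s * L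
        length-prefix = trans (length-h* (take s w)) (cong (_* L) (length-take-≤ s w s≤w))
        P≤sL : P ≤ s * L
        P≤sL = ≤-trans P≤L (subst (_≤ s * L) (+-identityʳ L) (*-monoˡ-≤ L 1≤s))
        Pre+P≡sL : length Pre + P ≡ s * L
        Pre+P≡sL = trans (cong (_+ P) (trans (length-drop P _) (cong (_∸ P) length-prefix))) (m∸n+n≡m P≤sL)
        offset : length Pre ≤ j × L ≤ j ∸ length Pre × j ∸ length Pre < L + L + L
        offset = offset-in-window {s = s} Pre+P≡sL sL+L≤J J<sL+3L
        Pre≤j : length Pre ≤ j
        Pre≤j = proj₁ offset
        e = j ∸ length Pre
        L≤e : L ≤ e
        L≤e = proj₁ (proj₂ offset)
        e<3L : e < L + L + L
        e<3L = proj₂ (proj₂ offset)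
        j≤ : j ≤ length Pre + length (h* t)
        j≤ = subst (_≤ length Pre + length (h* t)) (m+[n∸m]≡n Pre≤j)
               (+-monoʳ-≤ (length Pre) (subst (e ≤_) (sym length-ht) (<⇒≤ e<3L)))
          where
          length-ht : length (h* t) ≡ L + L + L
          length-ht = trans (length-h* t) (trans (cong (_* L) length-t) (three L))
            where three : ∀ L → 3 * L ≡ L + L + L
                  three = solve-∀
        W≡Pre++ : W ≡ Pre ++ h* t ++ S
        W≡Pre++ = begin
          drop P (h* w)                                  ≡⟨ cong (λ y → drop P (h* y)) (take++drop≡id s w) ⟨
          drop P (h* (take s w ++ drop s w))             ≡⟨ cong (λ y → drop P (h* (take s w ++ y))) (take++drop≡id 3 (drop s w)) ⟨
          drop P (h* (take s w ++ t ++ rest))            ≡⟨ cong (drop P) (concatMap-++ h (take s w) _) ⟩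
          drop P (h* (take s w) ++ h* (t ++ rest))       ≡⟨ cong (λ y → drop P (h* (take s w) ++ y)) (concatMap-++ h t rest) ⟩
          drop P (h* (take s w) ++ h* t ++ S)            ≡⟨ drop-++ P _ _ (subst (P ≤_) (sym length-prefix) P≤sL) ⟩
          Pre ++ h* t ++ S                               ∎
          where open ≡-Reasoning
        split : W′ ++ x ∷ W″ ≡ Pre ++ insertAt (h* t) e x ++ S
        split = extension-in-factor Pre (h* t) S W′ W″ x (trans (sym W≡) W≡Pre++) Pre≤j j≤

      middle-extension : ∀ W′ W″ x → W ≡ W′ ++ W″ → 0 < length W″ → L + L ≤ length W′ + P →
                         HasSquare (W′ ++ x ∷ W″)
      middle-extension W′ W″ x W≡ W″>0 2L≤J = window-extension W′ W″ x W≡ (three-block-window 2L≤J J<wL 4≤w)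
        where
        P≤hw : P ≤ length (h* w)
        P≤hw = ≤-trans P≤L (subst (L ≤_) (sym (length-h* w)) (≤-trans L≤w (m≤m*n (length w) L)))
        J<wL : length W′ + P < length w * L
        J<wL = begin-strict
          length W′ + P                 <⟨ +-monoˡ-< P (m<m+n (length W′) W″>0) ⟩
          length W′ + length W″ + P     ≡⟨ cong (_+ P) (trans (sym (length-++ W′)) (cong length (sym W≡))) ⟩
          length W + P                  ≡⟨ cong (_+ P) (length-drop P (h* w)) ⟩
          length (h* w) ∸ P + P         ≡⟨ m∸n+n≡m P≤hw ⟩
          length (h* w)                 ≡⟨ length-h* w ⟩
          length w * L                  ∎
          where open ≤-Reasoning
        4≤w : 4 ≤ length w
        4≤w = ≤-trans (≤-trans (n≤1+n 4) 5≤L) L≤w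

      nearlyExtremal : NearlyExtremal W
      nearlyExtremal = squareFree-drop P (h* w) (h*-squareFree w sf) , inner-extensions
        where
        inner-extensions : ∀ W′ W″ x → W ≡ W′ ++ W″ → SquareFree (W′ ++ x ∷ W″) → (W′ ≡ []) ⊎ (W″ ≡ [])
        inner-extensions [] W″ x _ _ = inj₁ refl
        inner-extensions (a ∷ W′) [] x _ _ = inj₂ refl
        inner-extensions W′@(_ ∷ _) W″@(_ ∷ _) x W≡ sf-ext with length W′ + P <? L + L
        ... | yes start = ⊥-elim (sf-ext (start-extension W′ W″ x W≡ (s≤s z≤n) start))
        ... | no ¬start = ⊥-elim (sf-ext (middle-extension W′ W″ x W≡ (s≤s z≤n) (≮⇒≥ ¬start)))

    iterate-h* : ℕ → Word A
    iterate-h* zero = a₀ ∷ []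
    iterate-h* (suc k) = h* (iterate-h* k)

    iterate-h*-squareFree : ∀ k → SquareFree (iterate-h* k)
    iterate-h*-squareFree zero = squareFree-[ a₀ ]
    iterate-h*-squareFree (suc k) = h*-squareFree _ (iterate-h*-squareFree k)

    iterate-h*-head : ∀ k → ∃[ v ] iterate-h* k ≡ a₀ ∷ v
    iterate-h*-head zero = [] , refl
    iterate-h*-head (suc k) with iterate-h*-head k
    ... | v , eq = proj₁ h-a₀ ++ h* v , trans (cong h* eq) (cong (_++ h* v) (proj₂ h-a₀))

    length-h*-doubles : ∀ u → length u + length u ≤ length (h* u)
    length-h*-doubles u = subst₂ _≤_ (double (length u)) (sym (length-h* u))
                            (*-monoʳ-≤ (length u) (≤-trans (s≤s (s≤s z≤n)) 5≤L))
      where double : ∀ n → n * 2 ≡ n + n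
            double = solve-∀

    iterate-h*-length : ∀ k → k < length (iterate-h* k)
    iterate-h*-length zero = s≤s z≤n
    iterate-h*-length (suc k) = ≤-<-trans (iterate-h*-length k)
      (<-≤-trans (m<m+n (length u) (≤-trans (s≤s z≤n) (iterate-h*-length k))) (length-h*-doubles u))
      where u = iterate-h* k

    arbitrarily-long-nearlyExtremal : ∀ n → ∃[ W ] (NearlyExtremal W × n ≤ length W)
    arbitrarily-long-nearlyExtremal n with iterate-h*-head n
    ... | v , eq = drop P (h* (h* u)) , nearlyExtremal v sf , n≤W
      where
      u = a₀ ∷ v
      sf : SquareFree (h* u)
      sf = h*-squareFree u (subst SquareFree eq (iterate-h*-squareFree n))
      P≤hu : P ≤ length (h* u)
      P≤hu = ≤-trans P≤L (subst (L ≤_) (sym (length-h* u)) (m≤m+n L _))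
      n≤W : n ≤ length (drop P (h* (h* u)))
      n≤W = begin
        n                                    ≤⟨ <⇒≤ (subst (λ y → n < length y) eq (iterate-h*-length n)) ⟩
        length u                             ≤⟨ ≤-trans (m≤m+n _ (length u)) (length-h*-doubles u) ⟩
        length (h* u)                        ≡⟨ m+n∸n≡m _ P ⟨
        length (h* u) + P ∸ P                ≤⟨ ∸-monoˡ-≤ P (≤-trans (+-monoʳ-≤ _ P≤hu) (length-h*-doubles (h* u))) ⟩
        length (h* (h* u)) ∸ P               ≡⟨ length-drop P (h* (h* u)) ⟨
        length (drop P (h* (h* u)))          ∎
        where open ≤-Reasoning

-- The 35-uniform morphism hM

open SquareFreeDecision (_≟ᶠ_ {3})

pattern 𝟎 = zero
pattern 𝟏 = suc zero
pattern 𝟐 = suc (suc zero)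

-- For each letter x, a pair (i , p): inserting x creates a square of period
-- p + 1 starting at position i.
Certificate : Set
Certificate = ℕ × ℕ × ℕ × ℕ × ℕ × ℕ

claimed-square : Certificate → 𝔸₃ → ℕ × ℕ
claimed-square (i , p , _) 𝟎 = i , p
claimed-square (_ , _ , i , p , _) 𝟏 = i , p
claimed-square (_ , _ , _ , _ , i , p) 𝟐 = i , p

claimed-squareᵇ : Word 𝔸₃ → ℕ → Certificate → 𝔸₃ → Bool
claimed-squareᵇ u e c x = squareAtᵇ (insertAt u e x) (claimed-square c x)

certifiesᵇ : Word 𝔸₃ → ℕ → Certificate → Bool
certifiesᵇ u e c = claimed-squareᵇ u e c 𝟎 ∧ claimed-squareᵇ u e c 𝟏 ∧ claimed-squareᵇ u e c 𝟐

certifiesᵇ-sound : ∀ u e c → T (certifiesᵇ u e c) → ∀ (x : 𝔸₃) → HasSquare (insertAt u e x)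
certifiesᵇ-sound u e c t x = squareAtᵇ-sound (insertAt u e x) (claimed-square c x) (pick x)
  where
  open Equivalence
  square : 𝔸₃ → Bool
  square = claimed-squareᵇ u e c
  pick : ∀ x → T (square x)
  pick 𝟎 = proj₁ (to (T-∧ {square 𝟎}) t)
  pick 𝟏 = proj₁ (to (T-∧ {square 𝟏}) (proj₂ (to (T-∧ {square 𝟎}) t)))
  pick 𝟐 = proj₂ (to (T-∧ {square 𝟏}) (proj₂ (to (T-∧ {square 𝟎}) t)))

allCertifiedᵇ : Word 𝔸₃ → ℕ → ℕ → List Certificate → Bool
allCertifiedᵇ u e zero cs = true
allCertifiedᵇ u e (suc n) [] = false
allCertifiedᵇ u e (suc n) (c ∷ cs) = certifiesᵇ u e c ∧ allCertifiedᵇ u (suc e) n cs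

allCertifiedᵇ-sound : ∀ u a n cs → T (allCertifiedᵇ u a n cs) →
                      ∀ e → a ≤ e → e < a + n → ∀ x → HasSquare (insertAt u e x)
allCertifiedᵇ-sound u a zero cs _ e a≤e e<a+0 = ⊥-elim (<-irrefl refl (≤-<-trans a≤e (subst (e <_) (+-identityʳ a) e<a+0)))
allCertifiedᵇ-sound u a (suc n) [] () e a≤e e<a+n
allCertifiedᵇ-sound u a (suc n) (c ∷ cs) t e a≤e e<a+n with m≤n⇒m<n∨m≡n a≤e
... | inj₂ refl = certifiesᵇ-sound u a c (proj₁ (Equivalence.to (T-∧ {certifiesᵇ u a c}) t))
... | inj₁ a<e = allCertifiedᵇ-sound u (suc a) n cs (proj₂ (Equivalence.to (T-∧ {certifiesᵇ u a c}) t)) e a<e (subst (e <_) (+-suc a n) e<a+n)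

hM : 𝔸₃ → Word 𝔸₃
hM 𝟎 = 𝟎 ∷ 𝟐 ∷ 𝟏 ∷ 𝟐 ∷ 𝟎 ∷ 𝟐 ∷ 𝟏 ∷ 𝟎 ∷ 𝟏 ∷ 𝟐 ∷ 𝟏 ∷ 𝟎 ∷ 𝟐 ∷ 𝟎 ∷ 𝟏 ∷ 𝟐 ∷ 𝟎 ∷ 𝟐 ∷ 𝟏 ∷ 𝟐 ∷ 𝟎 ∷ 𝟏 ∷ 𝟎 ∷ 𝟐 ∷ 𝟎 ∷ 𝟏 ∷ 𝟐 ∷ 𝟎 ∷ 𝟐 ∷ 𝟏 ∷ 𝟎 ∷ 𝟏 ∷ 𝟐 ∷ 𝟎 ∷ 𝟏 ∷ []
hM 𝟏 = 𝟎 ∷ 𝟐 ∷ 𝟏 ∷ 𝟐 ∷ 𝟎 ∷ 𝟐 ∷ 𝟏 ∷ 𝟎 ∷ 𝟏 ∷ 𝟐 ∷ 𝟏 ∷ 𝟎 ∷ 𝟐 ∷ 𝟏 ∷ 𝟐 ∷ 𝟎 ∷ 𝟏 ∷ 𝟎 ∷ 𝟐 ∷ 𝟏 ∷ 𝟎 ∷ 𝟏 ∷ 𝟐 ∷ 𝟎 ∷ 𝟐 ∷ 𝟏 ∷ 𝟐 ∷ 𝟎 ∷ 𝟏 ∷ 𝟎 ∷ 𝟐 ∷ 𝟎 ∷ 𝟏 ∷ 𝟐 ∷ 𝟏 ∷ []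
hM 𝟐 = 𝟎 ∷ 𝟐 ∷ 𝟏 ∷ 𝟐 ∷ 𝟎 ∷ 𝟐 ∷ 𝟏 ∷ 𝟎 ∷ 𝟐 ∷ 𝟎 ∷ 𝟏 ∷ 𝟐 ∷ 𝟏 ∷ 𝟎 ∷ 𝟐 ∷ 𝟏 ∷ 𝟐 ∷ 𝟎 ∷ 𝟏 ∷ 𝟎 ∷ 𝟐 ∷ 𝟎 ∷ 𝟏 ∷ 𝟐 ∷ 𝟏 ∷ 𝟎 ∷ 𝟏 ∷ 𝟐 ∷ 𝟎 ∷ 𝟐 ∷ 𝟏 ∷ 𝟎 ∷ 𝟐 ∷ 𝟎 ∷ 𝟏 ∷ []

start-certificates : List Certificate
start-certificates =
    (0 , 0 , 1 , 0 , 1 , 1) ∷ (1 , 2 , 1 , 0 , 2 , 0) ∷ (1 , 10 , 3 , 0 , 2 , 0) ∷ (4 , 0 , 3 , 0 , 1 , 1) ∷ (4 , 0 , 4 , 2 , 5 , 0) ∷ (6 , 0 , 2 , 2 , 5 , 0)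
  ∷ (6 , 0 , 7 , 0 , 4 , 1) ∷ (3 , 3 , 7 , 0 , 8 , 0) ∷ (9 , 0 , 0 , 5 , 8 , 0) ∷ (9 , 0 , 5 , 2 , 10 , 0) ∷ (4 , 4 , 11 , 0 , 10 , 0) ∷ (11 , 3 , 11 , 0 , 12 , 0)
  ∷ (13 , 0 , 10 , 1 , 12 , 0) ∷ (13 , 0 , 14 , 0 , 7 , 3) ∷ (15 , 0 , 14 , 0 , 11 , 2) ∷ (15 , 0 , 13 , 1 , 16 , 0) ∷ (17 , 0 , 15 , 5 , 16 , 0) ∷ (17 , 0 , 18 , 0 , 15 , 1)
  ∷ (12 , 3 , 18 , 0 , 19 , 0) ∷ (20 , 0 , 19 , 2 , 19 , 0) ∷ (20 , 0 , 16 , 2 , 21 , 0) ∷ (19 , 1 , 22 , 0 , 21 , 0) ∷ (23 , 0 , 22 , 0 , 3 , 10) ∷ (23 , 0 , 24 , 0 , 20 , 2)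
  ∷ (22 , 1 , 24 , 0 , 25 , 0) ∷ (26 , 0 , 21 , 3 , 25 , 0) ∷ (26 , 0 , 27 , 0 , 17 , 5) ∷ (28 , 0 , 27 , 0 , 23 , 2) ∷ (28 , 0 , 26 , 1 , 29 , 0) ∷ (11 , 12 , 30 , 0 , 29 , 0)
  ∷ (27 , 2 , 30 , 0 , 31 , 0) ∷ (32 , 0 , 29 , 1 , 31 , 0) ∷ (32 , 0 , 31 , 5 , 33 , 0) ∷ (31 , 1 , 34 , 0 , 33 , 0) ∷ (35 , 0 , 34 , 0 , 28 , 3) ∷ (35 , 0 , 35 , 2 , 36 , 0)
  ∷ (37 , 0 , 32 , 2 , 36 , 0) ∷ (37 , 0 , 38 , 0 , 35 , 1) ∷ (38 , 2 , 38 , 0 , 39 , 0) ∷ (36 , 2 , 40 , 0 , 39 , 0) ∷ (41 , 0 , 40 , 0 , 38 , 1) ∷ (41 , 0 , 37 , 3 , 42 , 0)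
  ∷ (33 , 5 , 43 , 0 , 42 , 0) ∷ (39 , 2 , 43 , 0 , 44 , 0) ∷ (45 , 0 , 42 , 1 , 44 , 0) ∷ (45 , 0 , 46 , 0 , 27 , 12) ∷ (47 , 0 , 46 , 0 , 43 , 2) ∷ (47 , 0 , 45 , 1 , 48 , 0)
  ∷ (49 , 0 , 48 , 3 , 48 , 0) ∷ (49 , 0 , 50 , 0 , 47 , 1) ∷ (44 , 3 , 50 , 0 , 51 , 0) ∷ (48 , 2 , 52 , 0 , 51 , 0) ∷ (53 , 0 , 52 , 0 , 50 , 1) ∷ (53 , 0 , 54 , 0 , 34 , 11)
  ∷ (52 , 1 , 54 , 0 , 55 , 0) ∷ (56 , 0 , 49 , 3 , 55 , 0) ∷ (56 , 0 , 53 , 2 , 57 , 0) ∷ (55 , 1 , 58 , 0 , 57 , 0) ∷ (59 , 0 , 58 , 0 , 54 , 3) ∷ (59 , 0 , 51 , 5 , 60 , 0)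
  ∷ (61 , 0 , 56 , 2 , 60 , 0) ∷ (61 , 0 , 62 , 0 , 55 , 4)
  ∷ []

middle-certificates : Word 𝔸₃ → List Certificate
middle-certificates (𝟎 ∷ 𝟏 ∷ 𝟎 ∷ []) =
    (35 , 0 , 34 , 0 , 30 , 2) ∷ (35 , 0 , 33 , 1 , 36 , 0) ∷ (18 , 12 , 37 , 0 , 36 , 0) ∷ (34 , 2 , 37 , 0 , 38 , 0) ∷ (39 , 0 , 36 , 1 , 38 , 0) ∷ (39 , 0 , 39 , 3 , 40 , 0)
  ∷ (38 , 1 , 41 , 0 , 40 , 0) ∷ (42 , 0 , 41 , 0 , 35 , 3) ∷ (42 , 0 , 43 , 0 , 39 , 2) ∷ (41 , 1 , 43 , 0 , 44 , 0) ∷ (25 , 11 , 45 , 0 , 44 , 0) ∷ (46 , 0 , 45 , 0 , 43 , 1)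
  ∷ (46 , 0 , 40 , 3 , 47 , 0) ∷ (47 , 2 , 48 , 0 , 47 , 0) ∷ (44 , 2 , 48 , 0 , 49 , 0) ∷ (50 , 0 , 47 , 1 , 49 , 0) ∷ (50 , 0 , 51 , 0 , 50 , 2) ∷ (52 , 0 , 51 , 0 , 48 , 2)
  ∷ (52 , 0 , 50 , 1 , 53 , 0) ∷ (49 , 3 , 54 , 0 , 53 , 0) ∷ (55 , 0 , 54 , 0 , 45 , 5) ∷ (55 , 0 , 56 , 0 , 51 , 2) ∷ (54 , 1 , 56 , 0 , 57 , 0) ∷ (58 , 0 , 39 , 12 , 57 , 0)
  ∷ (58 , 0 , 55 , 2 , 59 , 0) ∷ (57 , 1 , 60 , 0 , 59 , 0) ∷ (60 , 3 , 60 , 0 , 61 , 0) ∷ (62 , 0 , 59 , 1 , 61 , 0) ∷ (62 , 0 , 63 , 0 , 56 , 3) ∷ (64 , 0 , 63 , 0 , 60 , 2)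
  ∷ (64 , 0 , 62 , 1 , 65 , 0) ∷ (66 , 0 , 46 , 11 , 65 , 0) ∷ (66 , 0 , 67 , 0 , 64 , 1) ∷ (61 , 3 , 67 , 0 , 68 , 0) ∷ (65 , 2 , 69 , 0 , 68 , 0) ∷ (70 , 0 , 69 , 0 , 67 , 1)
  ∷ (70 , 0 , 66 , 3 , 71 , 0) ∷ (63 , 5 , 72 , 0 , 71 , 0) ∷ (68 , 2 , 72 , 0 , 73 , 0) ∷ (74 , 0 , 67 , 4 , 73 , 0) ∷ (74 , 0 , 74 , 3 , 75 , 0) ∷ (73 , 1 , 76 , 0 , 75 , 0)
  ∷ (77 , 0 , 76 , 0 , 70 , 3) ∷ (77 , 0 , 78 , 0 , 74 , 2) ∷ (76 , 1 , 78 , 0 , 79 , 0) ∷ (78 , 10 , 80 , 0 , 79 , 0) ∷ (81 , 0 , 80 , 0 , 78 , 1) ∷ (81 , 0 , 75 , 3 , 82 , 0)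
  ∷ (83 , 0 , 79 , 2 , 82 , 0) ∷ (83 , 0 , 84 , 0 , 81 , 1) ∷ (80 , 3 , 84 , 0 , 85 , 0) ∷ (86 , 0 , 77 , 5 , 85 , 0) ∷ (86 , 0 , 82 , 2 , 87 , 0) ∷ (81 , 4 , 88 , 0 , 87 , 0)
  ∷ (88 , 3 , 88 , 0 , 89 , 0) ∷ (90 , 0 , 87 , 1 , 89 , 0) ∷ (90 , 0 , 91 , 0 , 84 , 3) ∷ (92 , 0 , 91 , 0 , 88 , 2) ∷ (92 , 0 , 90 , 1 , 93 , 0) ∷ (94 , 0 , 92 , 5 , 93 , 0)
  ∷ (94 , 0 , 95 , 0 , 92 , 1) ∷ (89 , 3 , 95 , 0 , 96 , 0) ∷ (97 , 0 , 96 , 2 , 96 , 0) ∷ (97 , 0 , 93 , 2 , 98 , 0) ∷ (96 , 1 , 99 , 0 , 98 , 0) ∷ (100 , 0 , 99 , 0 , 80 , 10)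
  ∷ (100 , 0 , 101 , 0 , 97 , 2) ∷ (99 , 1 , 101 , 0 , 102 , 0) ∷ (103 , 0 , 98 , 3 , 102 , 0) ∷ (103 , 0 , 104 , 0 , 94 , 5)
  ∷ []
middle-certificates (𝟎 ∷ 𝟏 ∷ 𝟐 ∷ []) =
    (35 , 0 , 34 , 0 , 30 , 2) ∷ (35 , 0 , 33 , 1 , 36 , 0) ∷ (18 , 12 , 37 , 0 , 36 , 0) ∷ (34 , 2 , 37 , 0 , 38 , 0) ∷ (39 , 0 , 36 , 1 , 38 , 0) ∷ (39 , 0 , 39 , 3 , 40 , 0)
  ∷ (38 , 1 , 41 , 0 , 40 , 0) ∷ (42 , 0 , 41 , 0 , 35 , 3) ∷ (42 , 0 , 43 , 0 , 39 , 2) ∷ (41 , 1 , 43 , 0 , 44 , 0) ∷ (25 , 11 , 45 , 0 , 44 , 0) ∷ (46 , 0 , 45 , 0 , 43 , 1)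
  ∷ (46 , 0 , 40 , 3 , 47 , 0) ∷ (47 , 2 , 48 , 0 , 47 , 0) ∷ (44 , 2 , 48 , 0 , 49 , 0) ∷ (50 , 0 , 47 , 1 , 49 , 0) ∷ (50 , 0 , 51 , 0 , 50 , 2) ∷ (52 , 0 , 51 , 0 , 48 , 2)
  ∷ (52 , 0 , 50 , 1 , 53 , 0) ∷ (49 , 3 , 54 , 0 , 53 , 0) ∷ (55 , 0 , 54 , 0 , 45 , 5) ∷ (55 , 0 , 56 , 0 , 51 , 2) ∷ (54 , 1 , 56 , 0 , 57 , 0) ∷ (58 , 0 , 39 , 12 , 57 , 0)
  ∷ (58 , 0 , 55 , 2 , 59 , 0) ∷ (57 , 1 , 60 , 0 , 59 , 0) ∷ (60 , 3 , 60 , 0 , 61 , 0) ∷ (62 , 0 , 59 , 1 , 61 , 0) ∷ (62 , 0 , 63 , 0 , 56 , 3) ∷ (64 , 0 , 63 , 0 , 60 , 2)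
  ∷ (64 , 0 , 62 , 1 , 65 , 0) ∷ (66 , 0 , 46 , 11 , 65 , 0) ∷ (66 , 0 , 67 , 0 , 64 , 1) ∷ (61 , 3 , 67 , 0 , 68 , 0) ∷ (65 , 2 , 69 , 0 , 68 , 0) ∷ (70 , 0 , 69 , 0 , 67 , 1)
  ∷ (70 , 0 , 66 , 3 , 71 , 0) ∷ (63 , 5 , 72 , 0 , 71 , 0) ∷ (68 , 2 , 72 , 0 , 73 , 0) ∷ (74 , 0 , 67 , 4 , 73 , 0) ∷ (74 , 0 , 73 , 5 , 75 , 0) ∷ (73 , 1 , 76 , 0 , 75 , 0)
  ∷ (77 , 0 , 76 , 0 , 70 , 3) ∷ (77 , 0 , 77 , 2 , 78 , 0) ∷ (79 , 0 , 74 , 2 , 78 , 0) ∷ (79 , 0 , 80 , 0 , 77 , 1) ∷ (80 , 2 , 80 , 0 , 81 , 0) ∷ (78 , 2 , 82 , 0 , 81 , 0)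
  ∷ (83 , 0 , 82 , 0 , 80 , 1) ∷ (83 , 0 , 79 , 3 , 84 , 0) ∷ (75 , 5 , 85 , 0 , 84 , 0) ∷ (81 , 2 , 85 , 0 , 86 , 0) ∷ (87 , 0 , 84 , 1 , 86 , 0) ∷ (87 , 0 , 88 , 0 , 63 , 12)
  ∷ (89 , 0 , 88 , 0 , 85 , 2) ∷ (89 , 0 , 87 , 1 , 90 , 0) ∷ (91 , 0 , 90 , 3 , 90 , 0) ∷ (91 , 0 , 92 , 0 , 89 , 1) ∷ (86 , 3 , 92 , 0 , 93 , 0) ∷ (90 , 2 , 94 , 0 , 93 , 0)
  ∷ (95 , 0 , 94 , 0 , 92 , 1) ∷ (95 , 0 , 96 , 0 , 76 , 11) ∷ (94 , 1 , 96 , 0 , 97 , 0) ∷ (98 , 0 , 91 , 3 , 97 , 0) ∷ (98 , 0 , 95 , 2 , 99 , 0) ∷ (97 , 1 , 100 , 0 , 99 , 0)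
  ∷ (101 , 0 , 100 , 0 , 96 , 3) ∷ (101 , 0 , 93 , 5 , 102 , 0) ∷ (103 , 0 , 98 , 2 , 102 , 0) ∷ (103 , 0 , 104 , 0 , 101 , 1)
  ∷ []
middle-certificates (𝟎 ∷ 𝟐 ∷ 𝟎 ∷ []) =
    (35 , 0 , 34 , 0 , 30 , 2) ∷ (35 , 0 , 33 , 1 , 36 , 0) ∷ (18 , 12 , 37 , 0 , 36 , 0) ∷ (34 , 2 , 37 , 0 , 38 , 0) ∷ (39 , 0 , 36 , 1 , 38 , 0) ∷ (39 , 0 , 38 , 5 , 40 , 0)
  ∷ (38 , 1 , 41 , 0 , 40 , 0) ∷ (42 , 0 , 41 , 0 , 35 , 3) ∷ (42 , 0 , 42 , 2 , 43 , 0) ∷ (44 , 0 , 39 , 2 , 43 , 0) ∷ (44 , 0 , 45 , 0 , 42 , 1) ∷ (45 , 2 , 45 , 0 , 46 , 0)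
  ∷ (43 , 2 , 47 , 0 , 46 , 0) ∷ (48 , 0 , 47 , 0 , 45 , 1) ∷ (48 , 0 , 44 , 3 , 49 , 0) ∷ (40 , 5 , 50 , 0 , 49 , 0) ∷ (46 , 2 , 50 , 0 , 51 , 0) ∷ (52 , 0 , 49 , 1 , 51 , 0)
  ∷ (52 , 0 , 53 , 0 , 34 , 12) ∷ (54 , 0 , 53 , 0 , 50 , 2) ∷ (54 , 0 , 52 , 1 , 55 , 0) ∷ (56 , 0 , 55 , 3 , 55 , 0) ∷ (56 , 0 , 57 , 0 , 54 , 1) ∷ (51 , 3 , 57 , 0 , 58 , 0)
  ∷ (55 , 2 , 59 , 0 , 58 , 0) ∷ (60 , 0 , 59 , 0 , 57 , 1) ∷ (60 , 0 , 61 , 0 , 41 , 11) ∷ (59 , 1 , 61 , 0 , 62 , 0) ∷ (63 , 0 , 56 , 3 , 62 , 0) ∷ (63 , 0 , 60 , 2 , 64 , 0)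
  ∷ (62 , 1 , 65 , 0 , 64 , 0) ∷ (66 , 0 , 65 , 0 , 61 , 3) ∷ (66 , 0 , 58 , 5 , 67 , 0) ∷ (68 , 0 , 63 , 2 , 67 , 0) ∷ (68 , 0 , 69 , 0 , 62 , 4) ∷ (70 , 0 , 69 , 0 , 69 , 3)
  ∷ (70 , 0 , 68 , 1 , 71 , 0) ∷ (65 , 3 , 72 , 0 , 71 , 0) ∷ (69 , 2 , 72 , 0 , 73 , 0) ∷ (74 , 0 , 71 , 1 , 73 , 0) ∷ (74 , 0 , 74 , 3 , 75 , 0) ∷ (73 , 1 , 76 , 0 , 75 , 0)
  ∷ (77 , 0 , 76 , 0 , 70 , 3) ∷ (77 , 0 , 78 , 0 , 74 , 2) ∷ (76 , 1 , 78 , 0 , 79 , 0) ∷ (78 , 10 , 80 , 0 , 79 , 0) ∷ (81 , 0 , 80 , 0 , 78 , 1) ∷ (81 , 0 , 75 , 3 , 82 , 0)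
  ∷ (83 , 0 , 79 , 2 , 82 , 0) ∷ (83 , 0 , 84 , 0 , 81 , 1) ∷ (80 , 3 , 84 , 0 , 85 , 0) ∷ (86 , 0 , 77 , 5 , 85 , 0) ∷ (86 , 0 , 82 , 2 , 87 , 0) ∷ (81 , 4 , 88 , 0 , 87 , 0)
  ∷ (88 , 3 , 88 , 0 , 89 , 0) ∷ (90 , 0 , 87 , 1 , 89 , 0) ∷ (90 , 0 , 91 , 0 , 84 , 3) ∷ (92 , 0 , 91 , 0 , 88 , 2) ∷ (92 , 0 , 90 , 1 , 93 , 0) ∷ (94 , 0 , 92 , 5 , 93 , 0)
  ∷ (94 , 0 , 95 , 0 , 92 , 1) ∷ (89 , 3 , 95 , 0 , 96 , 0) ∷ (97 , 0 , 96 , 2 , 96 , 0) ∷ (97 , 0 , 93 , 2 , 98 , 0) ∷ (96 , 1 , 99 , 0 , 98 , 0) ∷ (100 , 0 , 99 , 0 , 80 , 10)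
  ∷ (100 , 0 , 101 , 0 , 97 , 2) ∷ (99 , 1 , 101 , 0 , 102 , 0) ∷ (103 , 0 , 98 , 3 , 102 , 0) ∷ (103 , 0 , 104 , 0 , 94 , 5)
  ∷ []
middle-certificates (𝟎 ∷ 𝟐 ∷ 𝟏 ∷ []) =
    (35 , 0 , 34 , 0 , 30 , 2) ∷ (35 , 0 , 33 , 1 , 36 , 0) ∷ (18 , 12 , 37 , 0 , 36 , 0) ∷ (34 , 2 , 37 , 0 , 38 , 0) ∷ (39 , 0 , 36 , 1 , 38 , 0) ∷ (39 , 0 , 38 , 5 , 40 , 0)
  ∷ (38 , 1 , 41 , 0 , 40 , 0) ∷ (42 , 0 , 41 , 0 , 35 , 3) ∷ (42 , 0 , 42 , 2 , 43 , 0) ∷ (44 , 0 , 39 , 2 , 43 , 0) ∷ (44 , 0 , 45 , 0 , 42 , 1) ∷ (45 , 2 , 45 , 0 , 46 , 0)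
  ∷ (43 , 2 , 47 , 0 , 46 , 0) ∷ (48 , 0 , 47 , 0 , 45 , 1) ∷ (48 , 0 , 44 , 3 , 49 , 0) ∷ (40 , 5 , 50 , 0 , 49 , 0) ∷ (46 , 2 , 50 , 0 , 51 , 0) ∷ (52 , 0 , 49 , 1 , 51 , 0)
  ∷ (52 , 0 , 53 , 0 , 34 , 12) ∷ (54 , 0 , 53 , 0 , 50 , 2) ∷ (54 , 0 , 52 , 1 , 55 , 0) ∷ (56 , 0 , 55 , 3 , 55 , 0) ∷ (56 , 0 , 57 , 0 , 54 , 1) ∷ (51 , 3 , 57 , 0 , 58 , 0)
  ∷ (55 , 2 , 59 , 0 , 58 , 0) ∷ (60 , 0 , 59 , 0 , 57 , 1) ∷ (60 , 0 , 61 , 0 , 41 , 11) ∷ (59 , 1 , 61 , 0 , 62 , 0) ∷ (63 , 0 , 56 , 3 , 62 , 0) ∷ (63 , 0 , 60 , 2 , 64 , 0)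
  ∷ (62 , 1 , 65 , 0 , 64 , 0) ∷ (66 , 0 , 65 , 0 , 61 , 3) ∷ (66 , 0 , 58 , 5 , 67 , 0) ∷ (68 , 0 , 63 , 2 , 67 , 0) ∷ (68 , 0 , 69 , 0 , 62 , 4) ∷ (70 , 0 , 69 , 0 , 69 , 3)
  ∷ (70 , 0 , 68 , 1 , 71 , 0) ∷ (65 , 3 , 72 , 0 , 71 , 0) ∷ (69 , 2 , 72 , 0 , 73 , 0) ∷ (74 , 0 , 71 , 1 , 73 , 0) ∷ (74 , 0 , 74 , 3 , 75 , 0) ∷ (73 , 1 , 76 , 0 , 75 , 0)
  ∷ (77 , 0 , 76 , 0 , 70 , 3) ∷ (77 , 0 , 78 , 0 , 74 , 2) ∷ (76 , 1 , 78 , 0 , 79 , 0) ∷ (78 , 5 , 80 , 0 , 79 , 0) ∷ (81 , 0 , 80 , 0 , 78 , 1) ∷ (81 , 0 , 75 , 3 , 82 , 0)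
  ∷ (82 , 2 , 83 , 0 , 82 , 0) ∷ (79 , 2 , 83 , 0 , 84 , 0) ∷ (85 , 0 , 82 , 1 , 84 , 0) ∷ (85 , 0 , 86 , 0 , 85 , 2) ∷ (87 , 0 , 86 , 0 , 83 , 2) ∷ (87 , 0 , 85 , 1 , 88 , 0)
  ∷ (84 , 3 , 89 , 0 , 88 , 0) ∷ (90 , 0 , 89 , 0 , 80 , 5) ∷ (90 , 0 , 91 , 0 , 86 , 2) ∷ (89 , 1 , 91 , 0 , 92 , 0) ∷ (93 , 0 , 74 , 12 , 92 , 0) ∷ (93 , 0 , 90 , 2 , 94 , 0)
  ∷ (92 , 1 , 95 , 0 , 94 , 0) ∷ (95 , 3 , 95 , 0 , 96 , 0) ∷ (97 , 0 , 94 , 1 , 96 , 0) ∷ (97 , 0 , 98 , 0 , 91 , 3) ∷ (99 , 0 , 98 , 0 , 95 , 2) ∷ (99 , 0 , 97 , 1 , 100 , 0)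
  ∷ (101 , 0 , 81 , 11 , 100 , 0) ∷ (101 , 0 , 102 , 0 , 99 , 1) ∷ (96 , 3 , 102 , 0 , 103 , 0) ∷ (100 , 2 , 104 , 0 , 103 , 0)
  ∷ []
middle-certificates (𝟏 ∷ 𝟎 ∷ 𝟏 ∷ []) =
    (35 , 0 , 34 , 0 , 32 , 1) ∷ (35 , 0 , 31 , 3 , 36 , 0) ∷ (28 , 5 , 37 , 0 , 36 , 0) ∷ (33 , 2 , 37 , 0 , 38 , 0) ∷ (39 , 0 , 32 , 4 , 38 , 0) ∷ (39 , 0 , 39 , 3 , 40 , 0)
  ∷ (38 , 1 , 41 , 0 , 40 , 0) ∷ (42 , 0 , 41 , 0 , 35 , 3) ∷ (42 , 0 , 43 , 0 , 39 , 2) ∷ (41 , 1 , 43 , 0 , 44 , 0) ∷ (43 , 10 , 45 , 0 , 44 , 0) ∷ (46 , 0 , 45 , 0 , 43 , 1)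
  ∷ (46 , 0 , 40 , 3 , 47 , 0) ∷ (48 , 0 , 44 , 2 , 47 , 0) ∷ (48 , 0 , 49 , 0 , 46 , 1) ∷ (45 , 3 , 49 , 0 , 50 , 0) ∷ (51 , 0 , 42 , 5 , 50 , 0) ∷ (51 , 0 , 47 , 2 , 52 , 0)
  ∷ (46 , 4 , 53 , 0 , 52 , 0) ∷ (53 , 3 , 53 , 0 , 54 , 0) ∷ (55 , 0 , 52 , 1 , 54 , 0) ∷ (55 , 0 , 56 , 0 , 49 , 3) ∷ (57 , 0 , 56 , 0 , 53 , 2) ∷ (57 , 0 , 55 , 1 , 58 , 0)
  ∷ (59 , 0 , 57 , 5 , 58 , 0) ∷ (59 , 0 , 60 , 0 , 57 , 1) ∷ (54 , 3 , 60 , 0 , 61 , 0) ∷ (62 , 0 , 61 , 2 , 61 , 0) ∷ (62 , 0 , 58 , 2 , 63 , 0) ∷ (61 , 1 , 64 , 0 , 63 , 0)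
  ∷ (65 , 0 , 64 , 0 , 45 , 10) ∷ (65 , 0 , 66 , 0 , 62 , 2) ∷ (64 , 1 , 66 , 0 , 67 , 0) ∷ (68 , 0 , 63 , 3 , 67 , 0) ∷ (68 , 0 , 69 , 0 , 59 , 5) ∷ (70 , 0 , 69 , 0 , 65 , 2)
  ∷ (70 , 0 , 68 , 1 , 71 , 0) ∷ (53 , 12 , 72 , 0 , 71 , 0) ∷ (69 , 2 , 72 , 0 , 73 , 0) ∷ (74 , 0 , 71 , 1 , 73 , 0) ∷ (74 , 0 , 74 , 3 , 75 , 0) ∷ (73 , 1 , 76 , 0 , 75 , 0)
  ∷ (77 , 0 , 76 , 0 , 70 , 3) ∷ (77 , 0 , 78 , 0 , 74 , 2) ∷ (76 , 1 , 78 , 0 , 79 , 0) ∷ (60 , 11 , 80 , 0 , 79 , 0) ∷ (81 , 0 , 80 , 0 , 78 , 1) ∷ (81 , 0 , 75 , 3 , 82 , 0)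
  ∷ (82 , 2 , 83 , 0 , 82 , 0) ∷ (79 , 2 , 83 , 0 , 84 , 0) ∷ (85 , 0 , 82 , 1 , 84 , 0) ∷ (85 , 0 , 86 , 0 , 85 , 2) ∷ (87 , 0 , 86 , 0 , 83 , 2) ∷ (87 , 0 , 85 , 1 , 88 , 0)
  ∷ (84 , 3 , 89 , 0 , 88 , 0) ∷ (90 , 0 , 89 , 0 , 80 , 5) ∷ (90 , 0 , 91 , 0 , 86 , 2) ∷ (89 , 1 , 91 , 0 , 92 , 0) ∷ (93 , 0 , 74 , 12 , 92 , 0) ∷ (93 , 0 , 90 , 2 , 94 , 0)
  ∷ (92 , 1 , 95 , 0 , 94 , 0) ∷ (95 , 3 , 95 , 0 , 96 , 0) ∷ (97 , 0 , 94 , 1 , 96 , 0) ∷ (97 , 0 , 98 , 0 , 91 , 3) ∷ (99 , 0 , 98 , 0 , 95 , 2) ∷ (99 , 0 , 97 , 1 , 100 , 0)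
  ∷ (101 , 0 , 81 , 11 , 100 , 0) ∷ (101 , 0 , 102 , 0 , 99 , 1) ∷ (96 , 3 , 102 , 0 , 103 , 0) ∷ (100 , 2 , 104 , 0 , 103 , 0)
  ∷ []
middle-certificates (𝟏 ∷ 𝟎 ∷ 𝟐 ∷ []) =
    (35 , 0 , 34 , 0 , 32 , 1) ∷ (35 , 0 , 31 , 3 , 36 , 0) ∷ (28 , 5 , 37 , 0 , 36 , 0) ∷ (33 , 2 , 37 , 0 , 38 , 0) ∷ (39 , 0 , 32 , 4 , 38 , 0) ∷ (39 , 0 , 39 , 3 , 40 , 0)
  ∷ (38 , 1 , 41 , 0 , 40 , 0) ∷ (42 , 0 , 41 , 0 , 35 , 3) ∷ (42 , 0 , 43 , 0 , 39 , 2) ∷ (41 , 1 , 43 , 0 , 44 , 0) ∷ (43 , 10 , 45 , 0 , 44 , 0) ∷ (46 , 0 , 45 , 0 , 43 , 1)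
  ∷ (46 , 0 , 40 , 3 , 47 , 0) ∷ (48 , 0 , 44 , 2 , 47 , 0) ∷ (48 , 0 , 49 , 0 , 46 , 1) ∷ (45 , 3 , 49 , 0 , 50 , 0) ∷ (51 , 0 , 42 , 5 , 50 , 0) ∷ (51 , 0 , 47 , 2 , 52 , 0)
  ∷ (46 , 4 , 53 , 0 , 52 , 0) ∷ (53 , 3 , 53 , 0 , 54 , 0) ∷ (55 , 0 , 52 , 1 , 54 , 0) ∷ (55 , 0 , 56 , 0 , 49 , 3) ∷ (57 , 0 , 56 , 0 , 53 , 2) ∷ (57 , 0 , 55 , 1 , 58 , 0)
  ∷ (59 , 0 , 57 , 5 , 58 , 0) ∷ (59 , 0 , 60 , 0 , 57 , 1) ∷ (54 , 3 , 60 , 0 , 61 , 0) ∷ (62 , 0 , 61 , 2 , 61 , 0) ∷ (62 , 0 , 58 , 2 , 63 , 0) ∷ (61 , 1 , 64 , 0 , 63 , 0)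
  ∷ (65 , 0 , 64 , 0 , 45 , 10) ∷ (65 , 0 , 66 , 0 , 62 , 2) ∷ (64 , 1 , 66 , 0 , 67 , 0) ∷ (68 , 0 , 63 , 3 , 67 , 0) ∷ (68 , 0 , 69 , 0 , 59 , 5) ∷ (70 , 0 , 69 , 0 , 65 , 2)
  ∷ (70 , 0 , 68 , 1 , 71 , 0) ∷ (53 , 12 , 72 , 0 , 71 , 0) ∷ (69 , 2 , 72 , 0 , 73 , 0) ∷ (74 , 0 , 71 , 1 , 73 , 0) ∷ (74 , 0 , 73 , 5 , 75 , 0) ∷ (73 , 1 , 76 , 0 , 75 , 0)
  ∷ (77 , 0 , 76 , 0 , 70 , 3) ∷ (77 , 0 , 77 , 2 , 78 , 0) ∷ (79 , 0 , 74 , 2 , 78 , 0) ∷ (79 , 0 , 80 , 0 , 77 , 1) ∷ (80 , 2 , 80 , 0 , 81 , 0) ∷ (78 , 2 , 82 , 0 , 81 , 0)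
  ∷ (83 , 0 , 82 , 0 , 80 , 1) ∷ (83 , 0 , 79 , 3 , 84 , 0) ∷ (75 , 5 , 85 , 0 , 84 , 0) ∷ (81 , 2 , 85 , 0 , 86 , 0) ∷ (87 , 0 , 84 , 1 , 86 , 0) ∷ (87 , 0 , 88 , 0 , 69 , 12)
  ∷ (89 , 0 , 88 , 0 , 85 , 2) ∷ (89 , 0 , 87 , 1 , 90 , 0) ∷ (91 , 0 , 90 , 3 , 90 , 0) ∷ (91 , 0 , 92 , 0 , 89 , 1) ∷ (86 , 3 , 92 , 0 , 93 , 0) ∷ (90 , 2 , 94 , 0 , 93 , 0)
  ∷ (95 , 0 , 94 , 0 , 92 , 1) ∷ (95 , 0 , 96 , 0 , 76 , 11) ∷ (94 , 1 , 96 , 0 , 97 , 0) ∷ (98 , 0 , 91 , 3 , 97 , 0) ∷ (98 , 0 , 95 , 2 , 99 , 0) ∷ (97 , 1 , 100 , 0 , 99 , 0)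
  ∷ (101 , 0 , 100 , 0 , 96 , 3) ∷ (101 , 0 , 93 , 5 , 102 , 0) ∷ (103 , 0 , 98 , 2 , 102 , 0) ∷ (103 , 0 , 104 , 0 , 101 , 1)
  ∷ []
middle-certificates (𝟏 ∷ 𝟐 ∷ 𝟎 ∷ []) =
    (35 , 0 , 34 , 0 , 32 , 1) ∷ (35 , 0 , 31 , 3 , 36 , 0) ∷ (28 , 5 , 37 , 0 , 36 , 0) ∷ (33 , 2 , 37 , 0 , 38 , 0) ∷ (39 , 0 , 32 , 4 , 38 , 0) ∷ (39 , 0 , 38 , 5 , 40 , 0)
  ∷ (38 , 1 , 41 , 0 , 40 , 0) ∷ (42 , 0 , 41 , 0 , 35 , 3) ∷ (42 , 0 , 42 , 2 , 43 , 0) ∷ (44 , 0 , 39 , 2 , 43 , 0) ∷ (44 , 0 , 45 , 0 , 42 , 1) ∷ (45 , 2 , 45 , 0 , 46 , 0)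
  ∷ (43 , 2 , 47 , 0 , 46 , 0) ∷ (48 , 0 , 47 , 0 , 45 , 1) ∷ (48 , 0 , 44 , 3 , 49 , 0) ∷ (40 , 5 , 50 , 0 , 49 , 0) ∷ (46 , 2 , 50 , 0 , 51 , 0) ∷ (52 , 0 , 49 , 1 , 51 , 0)
  ∷ (52 , 0 , 53 , 0 , 28 , 12) ∷ (54 , 0 , 53 , 0 , 50 , 2) ∷ (54 , 0 , 52 , 1 , 55 , 0) ∷ (56 , 0 , 55 , 3 , 55 , 0) ∷ (56 , 0 , 57 , 0 , 54 , 1) ∷ (51 , 3 , 57 , 0 , 58 , 0)
  ∷ (55 , 2 , 59 , 0 , 58 , 0) ∷ (60 , 0 , 59 , 0 , 57 , 1) ∷ (60 , 0 , 61 , 0 , 41 , 11) ∷ (59 , 1 , 61 , 0 , 62 , 0) ∷ (63 , 0 , 56 , 3 , 62 , 0) ∷ (63 , 0 , 60 , 2 , 64 , 0)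
  ∷ (62 , 1 , 65 , 0 , 64 , 0) ∷ (66 , 0 , 65 , 0 , 61 , 3) ∷ (66 , 0 , 58 , 5 , 67 , 0) ∷ (68 , 0 , 63 , 2 , 67 , 0) ∷ (68 , 0 , 69 , 0 , 62 , 4) ∷ (70 , 0 , 69 , 0 , 69 , 3)
  ∷ (70 , 0 , 68 , 1 , 71 , 0) ∷ (65 , 3 , 72 , 0 , 71 , 0) ∷ (69 , 2 , 72 , 0 , 73 , 0) ∷ (74 , 0 , 71 , 1 , 73 , 0) ∷ (74 , 0 , 74 , 3 , 75 , 0) ∷ (73 , 1 , 76 , 0 , 75 , 0)
  ∷ (77 , 0 , 76 , 0 , 70 , 3) ∷ (77 , 0 , 78 , 0 , 74 , 2) ∷ (76 , 1 , 78 , 0 , 79 , 0) ∷ (78 , 10 , 80 , 0 , 79 , 0) ∷ (81 , 0 , 80 , 0 , 78 , 1) ∷ (81 , 0 , 75 , 3 , 82 , 0)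
  ∷ (83 , 0 , 79 , 2 , 82 , 0) ∷ (83 , 0 , 84 , 0 , 81 , 1) ∷ (80 , 3 , 84 , 0 , 85 , 0) ∷ (86 , 0 , 77 , 5 , 85 , 0) ∷ (86 , 0 , 82 , 2 , 87 , 0) ∷ (81 , 4 , 88 , 0 , 87 , 0)
  ∷ (88 , 3 , 88 , 0 , 89 , 0) ∷ (90 , 0 , 87 , 1 , 89 , 0) ∷ (90 , 0 , 91 , 0 , 84 , 3) ∷ (92 , 0 , 91 , 0 , 88 , 2) ∷ (92 , 0 , 90 , 1 , 93 , 0) ∷ (94 , 0 , 92 , 5 , 93 , 0)
  ∷ (94 , 0 , 95 , 0 , 92 , 1) ∷ (89 , 3 , 95 , 0 , 96 , 0) ∷ (97 , 0 , 96 , 2 , 96 , 0) ∷ (97 , 0 , 93 , 2 , 98 , 0) ∷ (96 , 1 , 99 , 0 , 98 , 0) ∷ (100 , 0 , 99 , 0 , 80 , 10)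
  ∷ (100 , 0 , 101 , 0 , 97 , 2) ∷ (99 , 1 , 101 , 0 , 102 , 0) ∷ (103 , 0 , 98 , 3 , 102 , 0) ∷ (103 , 0 , 104 , 0 , 94 , 5)
  ∷ []
middle-certificates (𝟏 ∷ 𝟐 ∷ 𝟏 ∷ []) =
    (35 , 0 , 34 , 0 , 32 , 1) ∷ (35 , 0 , 31 , 3 , 36 , 0) ∷ (28 , 5 , 37 , 0 , 36 , 0) ∷ (33 , 2 , 37 , 0 , 38 , 0) ∷ (39 , 0 , 32 , 4 , 38 , 0) ∷ (39 , 0 , 38 , 5 , 40 , 0)
  ∷ (38 , 1 , 41 , 0 , 40 , 0) ∷ (42 , 0 , 41 , 0 , 35 , 3) ∷ (42 , 0 , 42 , 2 , 43 , 0) ∷ (44 , 0 , 39 , 2 , 43 , 0) ∷ (44 , 0 , 45 , 0 , 42 , 1) ∷ (45 , 2 , 45 , 0 , 46 , 0)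
  ∷ (43 , 2 , 47 , 0 , 46 , 0) ∷ (48 , 0 , 47 , 0 , 45 , 1) ∷ (48 , 0 , 44 , 3 , 49 , 0) ∷ (40 , 5 , 50 , 0 , 49 , 0) ∷ (46 , 2 , 50 , 0 , 51 , 0) ∷ (52 , 0 , 49 , 1 , 51 , 0)
  ∷ (52 , 0 , 53 , 0 , 28 , 12) ∷ (54 , 0 , 53 , 0 , 50 , 2) ∷ (54 , 0 , 52 , 1 , 55 , 0) ∷ (56 , 0 , 55 , 3 , 55 , 0) ∷ (56 , 0 , 57 , 0 , 54 , 1) ∷ (51 , 3 , 57 , 0 , 58 , 0)
  ∷ (55 , 2 , 59 , 0 , 58 , 0) ∷ (60 , 0 , 59 , 0 , 57 , 1) ∷ (60 , 0 , 61 , 0 , 41 , 11) ∷ (59 , 1 , 61 , 0 , 62 , 0) ∷ (63 , 0 , 56 , 3 , 62 , 0) ∷ (63 , 0 , 60 , 2 , 64 , 0)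
  ∷ (62 , 1 , 65 , 0 , 64 , 0) ∷ (66 , 0 , 65 , 0 , 61 , 3) ∷ (66 , 0 , 58 , 5 , 67 , 0) ∷ (68 , 0 , 63 , 2 , 67 , 0) ∷ (68 , 0 , 69 , 0 , 62 , 4) ∷ (70 , 0 , 69 , 0 , 69 , 3)
  ∷ (70 , 0 , 68 , 1 , 71 , 0) ∷ (65 , 3 , 72 , 0 , 71 , 0) ∷ (69 , 2 , 72 , 0 , 73 , 0) ∷ (74 , 0 , 71 , 1 , 73 , 0) ∷ (74 , 0 , 74 , 3 , 75 , 0) ∷ (73 , 1 , 76 , 0 , 75 , 0)
  ∷ (77 , 0 , 76 , 0 , 70 , 3) ∷ (77 , 0 , 78 , 0 , 74 , 2) ∷ (76 , 1 , 78 , 0 , 79 , 0) ∷ (78 , 5 , 80 , 0 , 79 , 0) ∷ (81 , 0 , 80 , 0 , 78 , 1) ∷ (81 , 0 , 75 , 3 , 82 , 0)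
  ∷ (82 , 2 , 83 , 0 , 82 , 0) ∷ (79 , 2 , 83 , 0 , 84 , 0) ∷ (85 , 0 , 82 , 1 , 84 , 0) ∷ (85 , 0 , 86 , 0 , 85 , 2) ∷ (87 , 0 , 86 , 0 , 83 , 2) ∷ (87 , 0 , 85 , 1 , 88 , 0)
  ∷ (84 , 3 , 89 , 0 , 88 , 0) ∷ (90 , 0 , 89 , 0 , 80 , 5) ∷ (90 , 0 , 91 , 0 , 86 , 2) ∷ (89 , 1 , 91 , 0 , 92 , 0) ∷ (93 , 0 , 74 , 12 , 92 , 0) ∷ (93 , 0 , 90 , 2 , 94 , 0)
  ∷ (92 , 1 , 95 , 0 , 94 , 0) ∷ (95 , 3 , 95 , 0 , 96 , 0) ∷ (97 , 0 , 94 , 1 , 96 , 0) ∷ (97 , 0 , 98 , 0 , 91 , 3) ∷ (99 , 0 , 98 , 0 , 95 , 2) ∷ (99 , 0 , 97 , 1 , 100 , 0)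
  ∷ (101 , 0 , 81 , 11 , 100 , 0) ∷ (101 , 0 , 102 , 0 , 99 , 1) ∷ (96 , 3 , 102 , 0 , 103 , 0) ∷ (100 , 2 , 104 , 0 , 103 , 0)
  ∷ []
middle-certificates (𝟐 ∷ 𝟎 ∷ 𝟏 ∷ []) =
    (35 , 0 , 34 , 0 , 34 , 3) ∷ (35 , 0 , 33 , 1 , 36 , 0) ∷ (30 , 3 , 37 , 0 , 36 , 0) ∷ (34 , 2 , 37 , 0 , 38 , 0) ∷ (39 , 0 , 36 , 1 , 38 , 0) ∷ (39 , 0 , 39 , 3 , 40 , 0)
  ∷ (38 , 1 , 41 , 0 , 40 , 0) ∷ (42 , 0 , 41 , 0 , 35 , 3) ∷ (42 , 0 , 43 , 0 , 39 , 2) ∷ (41 , 1 , 43 , 0 , 44 , 0) ∷ (43 , 10 , 45 , 0 , 44 , 0) ∷ (46 , 0 , 45 , 0 , 43 , 1)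
  ∷ (46 , 0 , 40 , 3 , 47 , 0) ∷ (48 , 0 , 44 , 2 , 47 , 0) ∷ (48 , 0 , 49 , 0 , 46 , 1) ∷ (45 , 3 , 49 , 0 , 50 , 0) ∷ (51 , 0 , 42 , 5 , 50 , 0) ∷ (51 , 0 , 47 , 2 , 52 , 0)
  ∷ (46 , 4 , 53 , 0 , 52 , 0) ∷ (53 , 3 , 53 , 0 , 54 , 0) ∷ (55 , 0 , 52 , 1 , 54 , 0) ∷ (55 , 0 , 56 , 0 , 49 , 3) ∷ (57 , 0 , 56 , 0 , 53 , 2) ∷ (57 , 0 , 55 , 1 , 58 , 0)
  ∷ (59 , 0 , 57 , 5 , 58 , 0) ∷ (59 , 0 , 60 , 0 , 57 , 1) ∷ (54 , 3 , 60 , 0 , 61 , 0) ∷ (62 , 0 , 61 , 2 , 61 , 0) ∷ (62 , 0 , 58 , 2 , 63 , 0) ∷ (61 , 1 , 64 , 0 , 63 , 0)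
  ∷ (65 , 0 , 64 , 0 , 45 , 10) ∷ (65 , 0 , 66 , 0 , 62 , 2) ∷ (64 , 1 , 66 , 0 , 67 , 0) ∷ (68 , 0 , 63 , 3 , 67 , 0) ∷ (68 , 0 , 69 , 0 , 59 , 5) ∷ (70 , 0 , 69 , 0 , 65 , 2)
  ∷ (70 , 0 , 68 , 1 , 71 , 0) ∷ (53 , 12 , 72 , 0 , 71 , 0) ∷ (69 , 2 , 72 , 0 , 73 , 0) ∷ (74 , 0 , 71 , 1 , 73 , 0) ∷ (74 , 0 , 74 , 3 , 75 , 0) ∷ (73 , 1 , 76 , 0 , 75 , 0)
  ∷ (77 , 0 , 76 , 0 , 70 , 3) ∷ (77 , 0 , 78 , 0 , 74 , 2) ∷ (76 , 1 , 78 , 0 , 79 , 0) ∷ (60 , 11 , 80 , 0 , 79 , 0) ∷ (81 , 0 , 80 , 0 , 78 , 1) ∷ (81 , 0 , 75 , 3 , 82 , 0)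
  ∷ (82 , 2 , 83 , 0 , 82 , 0) ∷ (79 , 2 , 83 , 0 , 84 , 0) ∷ (85 , 0 , 82 , 1 , 84 , 0) ∷ (85 , 0 , 86 , 0 , 85 , 2) ∷ (87 , 0 , 86 , 0 , 83 , 2) ∷ (87 , 0 , 85 , 1 , 88 , 0)
  ∷ (84 , 3 , 89 , 0 , 88 , 0) ∷ (90 , 0 , 89 , 0 , 80 , 5) ∷ (90 , 0 , 91 , 0 , 86 , 2) ∷ (89 , 1 , 91 , 0 , 92 , 0) ∷ (93 , 0 , 74 , 12 , 92 , 0) ∷ (93 , 0 , 90 , 2 , 94 , 0)
  ∷ (92 , 1 , 95 , 0 , 94 , 0) ∷ (95 , 3 , 95 , 0 , 96 , 0) ∷ (97 , 0 , 94 , 1 , 96 , 0) ∷ (97 , 0 , 98 , 0 , 91 , 3) ∷ (99 , 0 , 98 , 0 , 95 , 2) ∷ (99 , 0 , 97 , 1 , 100 , 0)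
  ∷ (101 , 0 , 81 , 11 , 100 , 0) ∷ (101 , 0 , 102 , 0 , 99 , 1) ∷ (96 , 3 , 102 , 0 , 103 , 0) ∷ (100 , 2 , 104 , 0 , 103 , 0)
  ∷ []
middle-certificates (𝟐 ∷ 𝟎 ∷ 𝟐 ∷ []) =
    (35 , 0 , 34 , 0 , 34 , 3) ∷ (35 , 0 , 33 , 1 , 36 , 0) ∷ (30 , 3 , 37 , 0 , 36 , 0) ∷ (34 , 2 , 37 , 0 , 38 , 0) ∷ (39 , 0 , 36 , 1 , 38 , 0) ∷ (39 , 0 , 39 , 3 , 40 , 0)
  ∷ (38 , 1 , 41 , 0 , 40 , 0) ∷ (42 , 0 , 41 , 0 , 35 , 3) ∷ (42 , 0 , 43 , 0 , 39 , 2) ∷ (41 , 1 , 43 , 0 , 44 , 0) ∷ (43 , 10 , 45 , 0 , 44 , 0) ∷ (46 , 0 , 45 , 0 , 43 , 1)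
  ∷ (46 , 0 , 40 , 3 , 47 , 0) ∷ (48 , 0 , 44 , 2 , 47 , 0) ∷ (48 , 0 , 49 , 0 , 46 , 1) ∷ (45 , 3 , 49 , 0 , 50 , 0) ∷ (51 , 0 , 42 , 5 , 50 , 0) ∷ (51 , 0 , 47 , 2 , 52 , 0)
  ∷ (46 , 4 , 53 , 0 , 52 , 0) ∷ (53 , 3 , 53 , 0 , 54 , 0) ∷ (55 , 0 , 52 , 1 , 54 , 0) ∷ (55 , 0 , 56 , 0 , 49 , 3) ∷ (57 , 0 , 56 , 0 , 53 , 2) ∷ (57 , 0 , 55 , 1 , 58 , 0)
  ∷ (59 , 0 , 57 , 5 , 58 , 0) ∷ (59 , 0 , 60 , 0 , 57 , 1) ∷ (54 , 3 , 60 , 0 , 61 , 0) ∷ (62 , 0 , 61 , 2 , 61 , 0) ∷ (62 , 0 , 58 , 2 , 63 , 0) ∷ (61 , 1 , 64 , 0 , 63 , 0)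
  ∷ (65 , 0 , 64 , 0 , 45 , 10) ∷ (65 , 0 , 66 , 0 , 62 , 2) ∷ (64 , 1 , 66 , 0 , 67 , 0) ∷ (68 , 0 , 63 , 3 , 67 , 0) ∷ (68 , 0 , 69 , 0 , 59 , 5) ∷ (70 , 0 , 69 , 0 , 65 , 2)
  ∷ (70 , 0 , 68 , 1 , 71 , 0) ∷ (53 , 12 , 72 , 0 , 71 , 0) ∷ (69 , 2 , 72 , 0 , 73 , 0) ∷ (74 , 0 , 71 , 1 , 73 , 0) ∷ (74 , 0 , 73 , 5 , 75 , 0) ∷ (73 , 1 , 76 , 0 , 75 , 0)
  ∷ (77 , 0 , 76 , 0 , 70 , 3) ∷ (77 , 0 , 77 , 2 , 78 , 0) ∷ (79 , 0 , 74 , 2 , 78 , 0) ∷ (79 , 0 , 80 , 0 , 77 , 1) ∷ (80 , 2 , 80 , 0 , 81 , 0) ∷ (78 , 2 , 82 , 0 , 81 , 0)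
  ∷ (83 , 0 , 82 , 0 , 80 , 1) ∷ (83 , 0 , 79 , 3 , 84 , 0) ∷ (75 , 5 , 85 , 0 , 84 , 0) ∷ (81 , 2 , 85 , 0 , 86 , 0) ∷ (87 , 0 , 84 , 1 , 86 , 0) ∷ (87 , 0 , 88 , 0 , 69 , 12)
  ∷ (89 , 0 , 88 , 0 , 85 , 2) ∷ (89 , 0 , 87 , 1 , 90 , 0) ∷ (91 , 0 , 90 , 3 , 90 , 0) ∷ (91 , 0 , 92 , 0 , 89 , 1) ∷ (86 , 3 , 92 , 0 , 93 , 0) ∷ (90 , 2 , 94 , 0 , 93 , 0)
  ∷ (95 , 0 , 94 , 0 , 92 , 1) ∷ (95 , 0 , 96 , 0 , 76 , 11) ∷ (94 , 1 , 96 , 0 , 97 , 0) ∷ (98 , 0 , 91 , 3 , 97 , 0) ∷ (98 , 0 , 95 , 2 , 99 , 0) ∷ (97 , 1 , 100 , 0 , 99 , 0)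
  ∷ (101 , 0 , 100 , 0 , 96 , 3) ∷ (101 , 0 , 93 , 5 , 102 , 0) ∷ (103 , 0 , 98 , 2 , 102 , 0) ∷ (103 , 0 , 104 , 0 , 101 , 1)
  ∷ []
middle-certificates (𝟐 ∷ 𝟏 ∷ 𝟎 ∷ []) =
    (35 , 0 , 34 , 0 , 34 , 3) ∷ (35 , 0 , 33 , 1 , 36 , 0) ∷ (30 , 3 , 37 , 0 , 36 , 0) ∷ (34 , 2 , 37 , 0 , 38 , 0) ∷ (39 , 0 , 36 , 1 , 38 , 0) ∷ (39 , 0 , 39 , 3 , 40 , 0)
  ∷ (38 , 1 , 41 , 0 , 40 , 0) ∷ (42 , 0 , 41 , 0 , 35 , 3) ∷ (42 , 0 , 43 , 0 , 39 , 2) ∷ (41 , 1 , 43 , 0 , 44 , 0) ∷ (43 , 5 , 45 , 0 , 44 , 0) ∷ (46 , 0 , 45 , 0 , 43 , 1)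
  ∷ (46 , 0 , 40 , 3 , 47 , 0) ∷ (47 , 2 , 48 , 0 , 47 , 0) ∷ (44 , 2 , 48 , 0 , 49 , 0) ∷ (50 , 0 , 47 , 1 , 49 , 0) ∷ (50 , 0 , 51 , 0 , 50 , 2) ∷ (52 , 0 , 51 , 0 , 48 , 2)
  ∷ (52 , 0 , 50 , 1 , 53 , 0) ∷ (49 , 3 , 54 , 0 , 53 , 0) ∷ (55 , 0 , 54 , 0 , 45 , 5) ∷ (55 , 0 , 56 , 0 , 51 , 2) ∷ (54 , 1 , 56 , 0 , 57 , 0) ∷ (58 , 0 , 39 , 12 , 57 , 0)
  ∷ (58 , 0 , 55 , 2 , 59 , 0) ∷ (57 , 1 , 60 , 0 , 59 , 0) ∷ (60 , 3 , 60 , 0 , 61 , 0) ∷ (62 , 0 , 59 , 1 , 61 , 0) ∷ (62 , 0 , 63 , 0 , 56 , 3) ∷ (64 , 0 , 63 , 0 , 60 , 2)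
  ∷ (64 , 0 , 62 , 1 , 65 , 0) ∷ (66 , 0 , 46 , 11 , 65 , 0) ∷ (66 , 0 , 67 , 0 , 64 , 1) ∷ (61 , 3 , 67 , 0 , 68 , 0) ∷ (65 , 2 , 69 , 0 , 68 , 0) ∷ (70 , 0 , 69 , 0 , 67 , 1)
  ∷ (70 , 0 , 66 , 3 , 71 , 0) ∷ (63 , 5 , 72 , 0 , 71 , 0) ∷ (68 , 2 , 72 , 0 , 73 , 0) ∷ (74 , 0 , 67 , 4 , 73 , 0) ∷ (74 , 0 , 74 , 3 , 75 , 0) ∷ (73 , 1 , 76 , 0 , 75 , 0)
  ∷ (77 , 0 , 76 , 0 , 70 , 3) ∷ (77 , 0 , 78 , 0 , 74 , 2) ∷ (76 , 1 , 78 , 0 , 79 , 0) ∷ (78 , 10 , 80 , 0 , 79 , 0) ∷ (81 , 0 , 80 , 0 , 78 , 1) ∷ (81 , 0 , 75 , 3 , 82 , 0)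
  ∷ (83 , 0 , 79 , 2 , 82 , 0) ∷ (83 , 0 , 84 , 0 , 81 , 1) ∷ (80 , 3 , 84 , 0 , 85 , 0) ∷ (86 , 0 , 77 , 5 , 85 , 0) ∷ (86 , 0 , 82 , 2 , 87 , 0) ∷ (81 , 4 , 88 , 0 , 87 , 0)
  ∷ (88 , 3 , 88 , 0 , 89 , 0) ∷ (90 , 0 , 87 , 1 , 89 , 0) ∷ (90 , 0 , 91 , 0 , 84 , 3) ∷ (92 , 0 , 91 , 0 , 88 , 2) ∷ (92 , 0 , 90 , 1 , 93 , 0) ∷ (94 , 0 , 92 , 5 , 93 , 0)
  ∷ (94 , 0 , 95 , 0 , 92 , 1) ∷ (89 , 3 , 95 , 0 , 96 , 0) ∷ (97 , 0 , 96 , 2 , 96 , 0) ∷ (97 , 0 , 93 , 2 , 98 , 0) ∷ (96 , 1 , 99 , 0 , 98 , 0) ∷ (100 , 0 , 99 , 0 , 80 , 10)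
  ∷ (100 , 0 , 101 , 0 , 97 , 2) ∷ (99 , 1 , 101 , 0 , 102 , 0) ∷ (103 , 0 , 98 , 3 , 102 , 0) ∷ (103 , 0 , 104 , 0 , 94 , 5)
  ∷ []
middle-certificates (𝟐 ∷ 𝟏 ∷ 𝟐 ∷ []) =
    (35 , 0 , 34 , 0 , 34 , 3) ∷ (35 , 0 , 33 , 1 , 36 , 0) ∷ (30 , 3 , 37 , 0 , 36 , 0) ∷ (34 , 2 , 37 , 0 , 38 , 0) ∷ (39 , 0 , 36 , 1 , 38 , 0) ∷ (39 , 0 , 39 , 3 , 40 , 0)
  ∷ (38 , 1 , 41 , 0 , 40 , 0) ∷ (42 , 0 , 41 , 0 , 35 , 3) ∷ (42 , 0 , 43 , 0 , 39 , 2) ∷ (41 , 1 , 43 , 0 , 44 , 0) ∷ (43 , 5 , 45 , 0 , 44 , 0) ∷ (46 , 0 , 45 , 0 , 43 , 1)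
  ∷ (46 , 0 , 40 , 3 , 47 , 0) ∷ (47 , 2 , 48 , 0 , 47 , 0) ∷ (44 , 2 , 48 , 0 , 49 , 0) ∷ (50 , 0 , 47 , 1 , 49 , 0) ∷ (50 , 0 , 51 , 0 , 50 , 2) ∷ (52 , 0 , 51 , 0 , 48 , 2)
  ∷ (52 , 0 , 50 , 1 , 53 , 0) ∷ (49 , 3 , 54 , 0 , 53 , 0) ∷ (55 , 0 , 54 , 0 , 45 , 5) ∷ (55 , 0 , 56 , 0 , 51 , 2) ∷ (54 , 1 , 56 , 0 , 57 , 0) ∷ (58 , 0 , 39 , 12 , 57 , 0)
  ∷ (58 , 0 , 55 , 2 , 59 , 0) ∷ (57 , 1 , 60 , 0 , 59 , 0) ∷ (60 , 3 , 60 , 0 , 61 , 0) ∷ (62 , 0 , 59 , 1 , 61 , 0) ∷ (62 , 0 , 63 , 0 , 56 , 3) ∷ (64 , 0 , 63 , 0 , 60 , 2)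
  ∷ (64 , 0 , 62 , 1 , 65 , 0) ∷ (66 , 0 , 46 , 11 , 65 , 0) ∷ (66 , 0 , 67 , 0 , 64 , 1) ∷ (61 , 3 , 67 , 0 , 68 , 0) ∷ (65 , 2 , 69 , 0 , 68 , 0) ∷ (70 , 0 , 69 , 0 , 67 , 1)
  ∷ (70 , 0 , 66 , 3 , 71 , 0) ∷ (63 , 5 , 72 , 0 , 71 , 0) ∷ (68 , 2 , 72 , 0 , 73 , 0) ∷ (74 , 0 , 67 , 4 , 73 , 0) ∷ (74 , 0 , 73 , 5 , 75 , 0) ∷ (73 , 1 , 76 , 0 , 75 , 0)
  ∷ (77 , 0 , 76 , 0 , 70 , 3) ∷ (77 , 0 , 77 , 2 , 78 , 0) ∷ (79 , 0 , 74 , 2 , 78 , 0) ∷ (79 , 0 , 80 , 0 , 77 , 1) ∷ (80 , 2 , 80 , 0 , 81 , 0) ∷ (78 , 2 , 82 , 0 , 81 , 0)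
  ∷ (83 , 0 , 82 , 0 , 80 , 1) ∷ (83 , 0 , 79 , 3 , 84 , 0) ∷ (75 , 5 , 85 , 0 , 84 , 0) ∷ (81 , 2 , 85 , 0 , 86 , 0) ∷ (87 , 0 , 84 , 1 , 86 , 0) ∷ (87 , 0 , 88 , 0 , 63 , 12)
  ∷ (89 , 0 , 88 , 0 , 85 , 2) ∷ (89 , 0 , 87 , 1 , 90 , 0) ∷ (91 , 0 , 90 , 3 , 90 , 0) ∷ (91 , 0 , 92 , 0 , 89 , 1) ∷ (86 , 3 , 92 , 0 , 93 , 0) ∷ (90 , 2 , 94 , 0 , 93 , 0)
  ∷ (95 , 0 , 94 , 0 , 92 , 1) ∷ (95 , 0 , 96 , 0 , 76 , 11) ∷ (94 , 1 , 96 , 0 , 97 , 0) ∷ (98 , 0 , 91 , 3 , 97 , 0) ∷ (98 , 0 , 95 , 2 , 99 , 0) ∷ (97 , 1 , 100 , 0 , 99 , 0)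
  ∷ (101 , 0 , 100 , 0 , 96 , 3) ∷ (101 , 0 , 93 , 5 , 102 , 0) ∷ (103 , 0 , 98 , 2 , 102 , 0) ∷ (103 , 0 , 104 , 0 , 101 , 1)
  ∷ []
middle-certificates _ = []

hM-uniform : ∀ a → length (hM a) ≡ 35
hM-uniform 𝟎 = refl
hM-uniform 𝟏 = refl
hM-uniform 𝟐 = refl

open UniformMorphism hM hM-uniform

hM-marker : ∀ a b → hM a ! 15 ≡ hM b ! 15 → a ≡ b
hM-marker = from-yes (all? λ a → all? λ b → ≡-decᵐ _≟ᶠ_ (hM a ! 15) (hM b ! 15) →-dec a ≟ᶠ b)

hM-synchronising : ∀ a b c t → 0 < t → t < 35 → ¬ (take 35 (drop t (hM a ++ hM b)) ≡ hM c)
hM-synchronising a b c t 0<t t<35 = from-yes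
  (all? λ a → all? λ b → all? λ c → allUpTo? (λ t → 0 <? t →-dec ¬? (≡-dec _≟ᶠ_ (take 35 (drop t (hM a ++ hM b))) (hM c))) 35)
  a b c t<35 0<t

hM-short : ∀ u → length u ≤ 5 → SquareFree u → SquareFree (h* u)
hM-short = from-yes (allWordsUpTo? all? (λ u → squareFree? u →-dec squareFree? (h* u)) 5)

hM-start-insertions : ∀ e → 0 < e → e + 7 < 35 + 35 → ∀ x →
                      HasSquare (insertAt (drop 7 (h* (take 5 (hM 𝟎)))) e x)
hM-start-insertions e 0<e e+7<70 =
  allCertifiedᵇ-sound _ 1 62 start-certificates checked e 0<e (+-cancelʳ-< 7 e 63 e+7<70)
  where
  checked : T (allCertifiedᵇ (drop 7 (h* (take 5 (hM 𝟎)))) 1 62 start-certificates)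
  checked = tt

hM-middle-insertions : ∀ t → length t ≡ 3 → SquareFree t → ∀ e → 35 ≤ e → e < 35 + 35 + 35 → ∀ x →
                       HasSquare (insertAt (h* t) e x)
hM-middle-insertions t t≡3 sf-t = allCertifiedᵇ-sound (h* t) 35 70 (middle-certificates t)
  (from-yes (allWordsUpTo? all? middle-checked? 3) t (≤-reflexive t≡3) t≡3 sf-t)
  where
  middle-checked? : ∀ t → Dec (length t ≡ 3 → SquareFree t → T (allCertifiedᵇ (h* t) 35 70 (middle-certificates t)))
  middle-checked? t = length t ≟ 3 →-dec squareFree? t →-dec T? _

open SquareFreeness {d = 15} (from-yes (15 <? 35)) hM-marker hM-synchronising hM-short
open NearlyExtremality h*-squareFree {a₀ = 𝟎} (_ , refl) {P = 7} (from-yes (7 ≤? 35)) (from-yes (5 ≤? 35))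
                       hM-start-insertions hM-middle-insertions

corollary1 : (n : ℕ) → .{{_ : NonZero n}} →
    ∃[ W ] (NearlyExtremal {𝔸₃} W × n ≤ length W)
corollary1 n = arbitrarily-long-nearlyExtremal n
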